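{- For all $k,r\ge 2$, let $(\mathbf j,\sigma)$ be a $k$-valid pair with $\mathbf j=(j_1,\dots,j_r)$ and $j_1\ge j_2\ge\dots\ge j_r$. Then \[f_{(\mathbf j,\sigma)}=\frac{\Pi(\mathbf j,\sigma)}{k^kr^{k-1}(rj_r+\sigma)}\left[j_r\Lambda(\mathbf j,\sigma)+\sigma\left(\frac{(2k+1-\sigma)(rj_r+\sigma)}{2j_r+1+\sigma}\right)^{\sigma}\right],\] where \[\Pi(\mathbf j,\sigma):=\binom{k-\sigma}{j_1,\dots,j_r}\prod_{s=1}^r(rj_s+\sigma)^{j_s}\quad\text{and}\quad \Lambda(\mathbf j,\sigma):=\sum_{\ell=1}^r\left(\frac{(2k+1-\sigma)(rj_\ell+\sigma)}{2j_\ell+1+\sigma}\right)^{\sigma}.\]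
   Context: A $k$-graph $H$ has vertex set $V(H)$ and edges which are $k$-subsets of $V(H)$; $\delta_1(H)$ is its minimum vertex degree. $\binom{n}{k_1,\dots,k_m}=\frac{n!}{k_1!\cdots k_m!}$ is the multinomial coefficient. Given a partition $\{V_1,\dots,V_r\}$ of $V(H)$, an edge $e$ has type $(t_1,\dots,t_r)$ if $|e\cap V_i|=t_i$ for all $i$; $\mathbf e_i$ is the $i$th standard unit vector of $\mathbb Z^r$. $(\mathbf j,\sigma)$ with $\mathbf j\in\mathbb N_0^r$, $\sigma\in\{ -1,1\}$ is $k$-valid if $\sigma+\sum_i j_i=k$ and $j_i+\sigma\ge0$ for all $i$. An $r$-edge-coloured $k$-graph $H$ is in $\mathcal F_{k,r}(\mathbf j,\sigma)$ if $n=|V(H)|$ is divisible by $kr$ and there is a partition $\{V_1,\dots,V_r\}$ of $V(H)$ with $|V_i|=\frac{rj_i+\sigma}{rk}n$ for all $i$ such that for each $i\in[r]$ every edge of colour $i$ has type $\mathbf j+\sigma\mathbf e_i$. Define \[f_{(\mathbf j,\sigma)}:=\lim_{n\to\infty}\max_{H\in\mathcal F_{k,r}(\mathbf j,\sigma),\,|V(H)|=krn}\frac{\delta_1(H)}{\binom{|V(H)|-1}{k-1}}.\] -}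

module Defs where

open import Data.Nat as ℕ using (ℕ; zero; suc; _⊓_; _!)
open import Data.Nat.Combinatorics using (_C_)
open import Data.Integer as ℤ using (ℤ; +_)
open import Data.Rational as ℚ using (ℚ; 0ℚ; 1ℚ)
open import Data.Rational.Properties using (_≟_)
open import Data.Sign using (Sign)
open import Data.Fin as Fin using (Fin; fromℕ)
open import Data.Fin.Subset using (Subset; ∣_∣; _∩_; inside; outside)
open import Data.Vec using (Vec; []; _∷_; lookup; tabulate)
open import Data.List using (List; []; _∷_; [_]; map; _++_; foldr; allFin)
open import Data.Maybe using (Maybe; just; is-just)
open import Data.Bool using (Bool; true; false; if_then_else_; _∧_)
open import Data.Product using (Σ; _×_)
open import Relation.Nullary using (yes; no)
open import Relation.Nullary.Decidable using (⌊_⌋)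
open import Relation.Binary.PropositionalEquality using (_≡_)

σℤ : Sign → ℤ
σℤ Sign.+ = ℤ.1ℤ
σℤ Sign.- = ℤ.-1ℤ

ℤ→ℚ : ℤ → ℚ
ℤ→ℚ z = z ℚ./ 1

ℕ→ℚ : ℕ → ℚ
ℕ→ℚ n = (+ n) ℚ./ 1

-- total division on ℚ (junk value 0 when dividing by 0; every use
-- below has a nonzero denominator in the relevant range)
_÷_ : ℚ → ℚ → ℚ
p ÷ q with q ≟ 0ℚ
... | yes _ = 0ℚ
... | no q≢0 = ℚ._÷_ p q {{ℚ.≢-nonZero q≢0}}

_^σ_ : ℚ → Sign → ℚ
x ^σ Sign.+ = x
x ^σ Sign.- = 1ℚ ÷ x

sumℕ : ∀ {r} → (Fin r → ℕ) → ℕ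
sumℕ {r} f = foldr ℕ._+_ 0 (map f (allFin r))

prodℕ : ∀ {r} → (Fin r → ℕ) → ℕ
prodℕ {r} f = foldr ℕ._*_ 1 (map f (allFin r))

sumℚ : ∀ {r} → (Fin r → ℚ) → ℚ
sumℚ {r} f = foldr ℚ._+_ 0ℚ (map f (allFin r))

prodℤ : ∀ {r} → (Fin r → ℤ) → ℤ
prodℤ {r} f = foldr ℤ._*_ ℤ.1ℤ (map f (allFin r))

multinomial : ∀ {r} → (Fin r → ℕ) → ℚ
multinomial j = ℕ→ℚ (sumℕ j !) ÷ ℕ→ℚ (prodℕ (λ i → j i !))

Valid : (k r : ℕ) → (Fin r → ℕ) → Sign → Set
Valid k r j σ = (σℤ σ ℤ.+ + sumℕ j ≡ + k) × (∀ i → ℤ.0ℤ ℤ.≤ + j i ℤ.+ σℤ σ)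

NonIncreasing : ∀ {r} → (Fin r → ℕ) → Set
NonIncreasing {r} j = ∀ (a b : Fin r) → a Fin.≤ b → j b ℕ.≤ j a

lastIx : (r : ℕ) → 2 ℕ.≤ r → Fin r
lastIx (suc m) _ = fromℕ m

rjσ : (r : ℕ) → ℕ → Sign → ℤ
rjσ r jℓ σ = + (r ℕ.* jℓ) ℤ.+ σℤ σ

term : (k r : ℕ) → ℕ → Sign → ℚ
term k r jℓ σ =
  (ℤ→ℚ ((+ (2 ℕ.* k ℕ.+ 1) ℤ.- σℤ σ) ℤ.* rjσ r jℓ σ)
    ÷ ℤ→ℚ (+ (2 ℕ.* jℓ ℕ.+ 1) ℤ.+ σℤ σ)) ^σ σ

-- Π(j,σ) = multinomial(k-σ; j₁,…,j_r) ∏_s (r j_s + σ)^{j_s}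
-- (note Σ j = k - σ for a k-valid pair)
Πf : (r : ℕ) → (Fin r → ℕ) → Sign → ℚ
Πf r j σ = multinomial j ℚ.* ℤ→ℚ (prodℤ (λ s → rjσ r (j s) σ ℤ.^ j s))

Λf : (k r : ℕ) → (Fin r → ℕ) → Sign → ℚ
Λf k r j σ = sumℚ (λ ℓ → term k r (j ℓ) σ)

formula : (k r : ℕ) → (hr : 2 ℕ.≤ r) → (Fin r → ℕ) → Sign → ℚ
formula k r hr j σ =
  (Πf r j σ ÷ ℤ→ℚ (+ (k ℕ.^ k ℕ.* r ℕ.^ (k ℕ.∸ 1)) ℤ.* rjσ r jr σ))
  ℚ.* (ℕ→ℚ jr ℚ.* Λf k r j σ ℚ.+ ℤ→ℚ (σℤ σ) ℚ.* term k r jr σ)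
  where jr = j (lastIx r hr)

-- each subset is either a non-edge (nothing) or an edge of colour c (just c);
-- edges are k-subsets
record ColHG (k r N : ℕ) : Set where
  field
    col     : Subset N → Maybe (Fin r)
    uniform : ∀ e c → col e ≡ just c → ∣ e ∣ ≡ k
open ColHG public

allSubsets : (n : ℕ) → List (Subset n)
allSubsets zero    = [ [] ]
allSubsets (suc n) = map (outside ∷_) (allSubsets n) ++ map (inside ∷_) (allSubsets n)

countᵇ : ∀ {A : Set} → (A → Bool) → List A → ℕ
countᵇ p = foldr (λ x acc → if p x then suc acc else acc) 0

deg : ∀ {k r N} → ColHG k r N → Fin N → ℕ
deg {N = N} H v = countᵇ (λ e → lookup e v ∧ is-just (col H e)) (allSubsets N)

-- minimum vertex degree δ₁(H) (the start value 2^N is an upper bound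
-- for every degree, so for N ≥ 1 this is exactly the minimum)
δ₁ : ∀ {k r N} → ColHG k r N → ℕ
δ₁ {N = N} H = foldr (λ v m → deg H v ⊓ m) (2 ℕ.^ N) (allFin N)

partSet : ∀ {r N} → (Fin N → Fin r) → Fin r → Subset N
partSet p i = tabulate (λ v → ⌊ p v Fin.≟ i ⌋)

-- H ∈ F_{k,r}(j,σ) with |V(H)| = N = k r n:
-- partition V_1..V_r with |V_i| = (r j_i + σ)/(rk) · N = (r j_i + σ) n,
-- and each edge of colour c has type j + σ e_c
InFamily : (k r : ℕ) → (Fin r → ℕ) → Sign → (n : ℕ) → ColHG k r (k ℕ.* r ℕ.* n) → Set
InFamily k r j σ n H =
  Σ (Fin (k ℕ.* r ℕ.* n) → Fin r) λ p →
    (∀ i → + ∣ partSet p i ∣ ≡ rjσ r (j i) σ ℤ.* + n) ×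
    (∀ e c → col H e ≡ just c → ∀ i →
       + ∣ e ∩ partSet p i ∣ ≡ + j i ℤ.+ (if ⌊ i Fin.≟ c ⌋ then σℤ σ else ℤ.0ℤ))

normDeg : ∀ {k r N} → ColHG k r N → ℚ
normDeg {k} {r} {N} H = ℕ→ℚ (δ₁ H) ÷ ℕ→ℚ ((N ℕ.∸ 1) C (k ℕ.∸ 1))

-- lim_{n→∞} max_{H ∈ F, |V(H)| = krn} normDeg H = L, in ε–N form
-- (the max is over a finite nonempty set; "max ≤ L+ε" = every H has
-- normDeg ≤ L+ε, "max ≥ L-ε" = some H has normDeg ≥ L-ε)
LimitOfMaxIs : (k r : ℕ) → (Fin r → ℕ) → Sign → ℚ → Set
LimitOfMaxIs k r j σ L =
  ∀ (ε : ℚ) → 0ℚ ℚ.< ε →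
    Σ ℕ λ N₀ → ∀ n → N₀ ℕ.≤ n →
      (∀ (H : ColHG k r (k ℕ.* r ℕ.* n)) → InFamily k r j σ n H → normDeg H ℚ.≤ L ℚ.+ ε) ×
      Σ (ColHG k r (k ℕ.* r ℕ.* n)) (λ H → InFamily k r j σ n H × L ℚ.- ε ℚ.≤ normDeg H)

-- Fix parts V_1, …, V_r with |V_i| = a_i n, where a_i = r j_i + σ, and give colour c the type
-- T_c = j + σ e_c.  A vertex of V_l lies in exactly (T_c(l) / a_l n) ∏_s C(a_s n, T_c(s)) of the
-- k-sets of type T_c, so its degree is at most the sum of these over c; as the types are pairwise
-- distinct, the hypergraph containing every k-set of every type T_c (in colour c) attains this
-- bound at every vertex.  Squeezing each C(m, t) between (m)_t / t! and m^t / t!, and using the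
-- Bernoulli-type bound n (n)_k ≥ n^(k+1) − k² n^k, the normalised degree of a vertex of V_l tends to
-- r S_l / (a_l (kr)^k), where S_l = Σ_c T_c(l) h_c and h_c = (k; T_c) ∏_s a_s^T_c(s).  Since j is
-- non-increasing this ratio is smallest for l = r, so its value there bounds δ₁ from above for
-- every member of the family and is attained by the complete member; that value is the formula.

module Submission where

open import Defs
open import Data.Nat using (ℕ; _≤_)
open import Data.Fin using (Fin)
open import Data.Sign using (Sign)

open import Data.Nat
open import Data.Nat.Properties
open import Data.Nat.Combinatorics as ℕC using (_C_; nCk≡nPk/k!; k>n⇒nCk≡0; k![n∸k]!∣n!; nCk+nC[k+1]≡[n+1]C[k+1])
open import Data.Nat.Combinatorics.Base using (_P′_)
open import Data.Nat.Combinatorics.Specification using (k!∣nP′k; nP′k≡n[n∸1P′k∸1])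
open import Data.Nat.DivMod using (m/n*n≡m)
open import Data.Nat.Divisibility using (_∣_; ∣-refl; ∣-trans; *-monoʳ-∣)
open import Data.Nat.Solver using (module +-*-Solver)
open import Data.Integer as ℤ using (ℤ)
import Data.Integer.Properties as ℤP
open import Data.Rational as ℚ using (ℚ; 0ℚ; 1ℚ; mkℚ; toℚᵘ)
import Data.Rational.Properties as ℚP
open import Data.Rational.Unnormalised as ℚᵘ using (mkℚᵘ; *≡*)
import Data.Rational.Unnormalised.Properties as ℚᵘP
open import Data.Fin as Fin using (zero; suc; punchIn; fromℕ)
open import Data.Fin.Properties as FinP using (punchInᵢ≢i; all?; any?; ¬∀⟶∃¬; ≤fromℕ)
open import Data.Fin.Subset using (Subset; ∣_∣; _∩_; inside; outside)
open import Data.Vec as Vec using (Vec; []; _∷_; lookup)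
open import Data.Vec.Functional as VF using (removeAt)
open import Data.List as List using (List; []; _∷_; _++_)
open import Data.List.Properties using (map-tabulate; map-cong; length-++; length-map)
open import Data.List.Membership.Propositional using (_∈_)
open import Data.List.Membership.Propositional.Properties using (∈-allFin)
open import Data.List.Relation.Unary.Any using (here; there)
open import Data.Bool using (Bool; true; false; if_then_else_; _∧_; _∨_)
open import Data.Bool.Properties using (∧-distribˡ-∨; ∧-zeroʳ)
open import Data.Maybe using (Maybe; just; nothing; is-just)
open import Data.Product as Product using (Σ; ∃; _,_; proj₁; proj₂; _×_)
open import Data.Sum as Sum using (_⊎_; inj₁; inj₂)
open import Data.Empty using (⊥; ⊥-elim)
open import Function using (_∘_; id; mk⇔)
open import Relation.Nullary using (¬_; Dec; yes; no; does; contradiction)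
open import Relation.Nullary.Decidable using (⌊_⌋; does-⇔; dec-false; dec-true)
open import Relation.Binary.PropositionalEquality
import Relation.Binary.Reasoning.Setoid as SetoidReasoning
import Algebra.Properties.CommutativeMonoid.Sum as CommutativeMonoidSum
import Algebra.Properties.Semiring.Sum as SemiringSum
open import Algebra.Properties.CommutativeSemigroup *-commutativeSemigroup using (x∙yz≈y∙xz) renaming (xy∙z≈xz∙y to *-right-comm; interchange to *-interchange)
import Algebra.Solver.Ring.Simple as RingSolver
import Algebra.Solver.Ring.AlmostCommutativeRing as ACR

open +-*-Solver using (solve; _:+_; _:*_; _:=_; con)

module ℚ-Solver = RingSolver (ACR.fromCommutativeRing ℚP.+-*-commutativeRing) ℚP._≟_
open ℚ-Solver using () renaming (solve to solveℚ; _:+_ to _⊕_; _:*_ to _⊛_; _:-_ to _⊖_; :-_ to ⊝_; _:=_ to _⊜_; con to conℚ)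
module ∑ℕ = CommutativeMonoidSum +-0-commutativeMonoid
module ∏ℕ = CommutativeMonoidSum *-1-commutativeMonoid


foldr-allFin : ∀ {A : Set} (_∙_ : A → A → A) (e : A) {r} (f : Fin r → A) →
  List.foldr _∙_ e (List.map f (List.allFin r)) ≡ VF.foldr _∙_ e f
foldr-allFin _∙_ e f = trans (cong (List.foldr _∙_ e) (map-tabulate id f)) (tabulate-foldr f)
  where
  tabulate-foldr : ∀ {r} (f : Fin r → _) → List.foldr _∙_ e (List.tabulate f) ≡ VF.foldr _∙_ e f
  tabulate-foldr {zero}  f = refl
  tabulate-foldr {suc r} f = cong (f zero ∙_) (tabulate-foldr (f ∘ suc))

∑ ∏ : ∀ {r} → (Fin r → ℕ) → ℕ
∑ = ∑ℕ.sum
∏ = ∏ℕ.sum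

sumℕ≡∑ : ∀ {r} (f : Fin r → ℕ) → sumℕ f ≡ ∑ f
sumℕ≡∑ = foldr-allFin _+_ 0

prodℕ≡∏ : ∀ {r} (f : Fin r → ℕ) → prodℕ f ≡ ∏ f
prodℕ≡∏ = foldr-allFin _*_ 1

∑-cong : ∀ {r} {f g : Fin r → ℕ} → (∀ i → f i ≡ g i) → ∑ f ≡ ∑ g
∑-cong = ∑ℕ.sum-cong-≗

∏-cong : ∀ {r} {f g : Fin r → ℕ} → (∀ i → f i ≡ g i) → ∏ f ≡ ∏ g
∏-cong = ∏ℕ.sum-cong-≗

∑-mono-≤ : ∀ {r} {f g : Fin r → ℕ} → (∀ i → f i ≤ g i) → ∑ f ≤ ∑ g
∑-mono-≤ {zero}  f≤g = z≤n
∑-mono-≤ {suc r} f≤g = +-mono-≤ (f≤g zero) (∑-mono-≤ (f≤g ∘ suc))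

∏-mono-≤ : ∀ {r} {f g : Fin r → ℕ} → (∀ i → f i ≤ g i) → ∏ f ≤ ∏ g
∏-mono-≤ {zero}  f≤g = ≤-refl
∏-mono-≤ {suc r} f≤g = *-mono-≤ (f≤g zero) (∏-mono-≤ (f≤g ∘ suc))

∑-distrib-+ : ∀ {r} (f g : Fin r → ℕ) → ∑ (λ i → f i + g i) ≡ ∑ f + ∑ g
∑-distrib-+ = ∑ℕ.∑-distrib-+

∏-distrib-* : ∀ {r} (f g : Fin r → ℕ) → ∏ (λ i → f i * g i) ≡ ∏ f * ∏ g
∏-distrib-* = ∏ℕ.∑-distrib-+

∑-*ˡ : ∀ {r} c (f : Fin r → ℕ) → ∑ (λ i → c * f i) ≡ c * ∑ f
∑-*ˡ c f = sym (SemiringSum.*-distribˡ-sum +-*-semiring c f)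

∑-*ʳ : ∀ {r} c (f : Fin r → ℕ) → ∑ (λ i → f i * c) ≡ ∑ f * c
∑-*ʳ c f = sym (SemiringSum.*-distribʳ-sum +-*-semiring c f)

∑-const : ∀ r m → ∑ {r} (λ _ → m) ≡ r * m
∑-const zero    m = refl
∑-const (suc r) m = cong (m +_) (∑-const r m)

∏-^ : ∀ {r} m (t : Fin r → ℕ) → ∏ (λ i → m ^ t i) ≡ m ^ ∑ t
∏-^ {zero}  m t = refl
∏-^ {suc r} m t = trans (cong (m ^ t zero *_) (∏-^ m (t ∘ suc))) (sym (^-distribˡ-+-* m (t zero) (∑ (t ∘ suc))))

∏-pos : ∀ {r} (f : Fin r → ℕ) → (∀ i → 0 < f i) → 0 < ∏ f
∏-pos {zero}  f f>0 = s≤s z≤n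
∏-pos {suc r} f f>0 = *-mono-< (f>0 zero) (∏-pos (f ∘ suc) (f>0 ∘ suc))

∏!∣∑! : ∀ {r} (t : Fin r → ℕ) → ∏ (λ s → t s !) ∣ (∑ t) !
∏!∣∑! {zero}  t = ∣-refl
∏!∣∑! {suc r} t = ∣-trans (*-monoʳ-∣ (t zero !) (∏!∣∑! (t ∘ suc)))
  (subst (λ m → t zero ! * m ! ∣ (t zero + ∑ (t ∘ suc)) !) (m+n∸m≡n (t zero) (∑ (t ∘ suc))) (k![n∸k]!∣n! (m≤m+n (t zero) _)))

cases-at : ∀ {r} {P : Fin r → Set} (c : Fin r) → P c → (∀ {s} → c ≢ s → P s) → ∀ s → P s
cases-at c Pc P-off s with c Fin.≟ s
... | yes refl = Pc
... | no c≢s   = P-off c≢s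

-- Kronecker delta, phrased like partSet so that part sizes unfold to it.
δ : ∀ {r} → Fin r → Fin r → ℕ
δ c i = if ⌊ c Fin.≟ i ⌋ then 1 else 0

δ-diag : ∀ {r} (c : Fin r) → δ c c ≡ 1
δ-diag c with c Fin.≟ c
... | yes _  = refl
... | no c≢c = ⊥-elim (c≢c refl)

δ-off : ∀ {r} {c i : Fin r} → c ≢ i → δ c i ≡ 0
δ-off {c = c} {i} c≢i with c Fin.≟ i
... | yes c≡i = ⊥-elim (c≢i c≡i)
... | no _    = refl

δ-suc : ∀ {r} (c i : Fin r) → δ (suc c) (suc i) ≡ δ c i
δ-suc c i = by (c Fin.≟ i)
  where
  by : Dec (c ≡ i) → δ (suc c) (suc i) ≡ δ c i
  by (yes refl) = trans (δ-diag (suc c)) (sym (δ-diag c))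
  by (no c≢i)   = trans (δ-off (c≢i ∘ FinP.suc-injective)) (sym (δ-off c≢i))

∑-single : ∀ {r} (l : Fin r) (f : Fin r → ℕ) → (∀ i → i ≢ l → f i ≡ 0) → ∑ f ≡ f l
∑-single {suc r} l f f-off = begin
  ∑ f                         ≡⟨ ∑ℕ.sum-remove {i = l} f ⟩
  f l + ∑ (removeAt f l)      ≡⟨ cong (f l +_) (∑-cong (λ i → f-off (punchIn l i) (punchInᵢ≢i l i))) ⟩
  f l + ∑ {r} (λ _ → 0)        ≡⟨ cong (f l +_) (trans (∑-const r 0) (*-zeroʳ r)) ⟩
  f l + 0                     ≡⟨ +-identityʳ (f l) ⟩
  f l                         ∎
  where open ≡-Reasoning

∑-δ : ∀ {r} (c : Fin r) → ∑ (δ c) ≡ 1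
∑-δ c = trans (∑-single c (δ c) (λ i i≢c → δ-off (i≢c ∘ sym))) (δ-diag c)

∑-δ-* : ∀ {r} (l : Fin r) (f : Fin r → ℕ) → ∑ (λ c → δ c l * f c) ≡ f l
∑-δ-* l f = trans (∑-single l _ (λ c c≢l → cong (_* f c) (δ-off c≢l))) (trans (cong (_* f l) (δ-diag l)) (*-identityˡ (f l)))

∑-≤-others : ∀ {r} (f : Fin r → ℕ) {b} → (∀ i → f i ≤ b) → ∀ l → ∑ f + b ≤ f l + r * b
∑-≤-others {suc m} f {b} f≤b l = begin
  ∑ f + b                              ≡⟨ cong (_+ b) (∑ℕ.sum-remove f) ⟩
  f l + ∑ (removeAt f l) + b           ≤⟨ +-monoˡ-≤ b (+-monoʳ-≤ (f l) (∑-mono-≤ (f≤b ∘ punchIn l))) ⟩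
  f l + ∑ {m} (λ _ → b) + b             ≡⟨ cong (λ x → f l + x + b) (∑-const m b) ⟩
  f l + m * b + b                      ≡⟨ solve 3 (λ x m b → x :+ m :* b :+ b := x :+ (con 1 :+ m) :* b) refl (f l) m b ⟩
  f l + suc m * b                      ∎
  where open ≤-Reasoning

∏-without-cong : ∀ {r} (c : Fin (suc r)) {f g : Fin (suc r) → ℕ} → (∀ i → c ≢ i → f i ≡ g i) →
  ∏ (removeAt f c) ≡ ∏ (removeAt g c)
∏-without-cong c agree = ∏-cong (λ i → agree (punchIn c i) (punchInᵢ≢i c i ∘ sym))

∏-scale-at : ∀ {r} (c : Fin r) {f g : Fin r → ℕ} {x y} → (∀ i → c ≢ i → f i ≡ g i) →
  f c * x ≡ g c * y → ∏ f * x ≡ ∏ g * y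
∏-scale-at {suc r} c {f} {g} {x} {y} agree eq = begin
  ∏ f * x                         ≡⟨ cong (_* x) (∏ℕ.sum-remove f) ⟩
  f c * ∏ (removeAt f c) * x      ≡⟨ *-right-comm (f c) _ x ⟩
  f c * x * ∏ (removeAt f c)      ≡⟨ cong₂ _*_ eq (∏-without-cong c agree) ⟩
  g c * y * ∏ (removeAt g c)      ≡⟨ *-right-comm (g c) y _ ⟩
  g c * ∏ (removeAt g c) * y      ≡⟨ cong (_* y) (∏ℕ.sum-remove g) ⟨
  ∏ g * y                         ∎
  where open ≡-Reasoning

∏-+-at : ∀ {r} (c : Fin r) {f g h : Fin r → ℕ} → (∀ i → c ≢ i → f i ≡ g i) → (∀ i → c ≢ i → f i ≡ h i) →
  f c ≡ g c + h c → ∏ f ≡ ∏ g + ∏ h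
∏-+-at {suc r} c {f} {g} {h} agreeᵍ agreeʰ eq = begin
  ∏ f
    ≡⟨ ∏ℕ.sum-remove f ⟩
  f c * ∏ (removeAt f c)
    ≡⟨ cong (_* ∏ (removeAt f c)) eq ⟩
  (g c + h c) * ∏ (removeAt f c)
    ≡⟨ *-distribʳ-+ _ (g c) (h c) ⟩
  g c * ∏ (removeAt f c) + h c * ∏ (removeAt f c)
    ≡⟨ cong₂ _+_ (cong (g c *_) (∏-without-cong c agreeᵍ)) (cong (h c *_) (∏-without-cong c agreeʰ)) ⟩
  g c * ∏ (removeAt g c) + h c * ∏ (removeAt h c)
    ≡⟨ cong₂ _+_ (∏ℕ.sum-remove g) (∏ℕ.sum-remove h) ⟨
  ∏ g + ∏ h                                            ∎
  where open ≡-Reasoning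

∏-zero-at : ∀ {r} (c : Fin r) (f : Fin r → ℕ) → f c ≡ 0 → ∏ f ≡ 0
∏-zero-at {suc r} c f fc≡0 = trans (∏ℕ.sum-remove f) (cong (_* ∏ (removeAt f c)) fc≡0)


-- Falling factorials and binomial coefficients

^-distribʳ-* : ∀ x y t → (x * y) ^ t ≡ x ^ t * y ^ t
^-distribʳ-* x y zero    = refl
^-distribʳ-* x y (suc t) = trans (cong (x * y *_) (^-distribʳ-* x y t)) (*-interchange x y (x ^ t) (y ^ t))

P′-zero : ∀ {n k} → n < k → n P′ k ≡ 0
P′-zero {n} {suc k} (s≤s n≤k) = cong (_* (n P′ k)) (m≤n⇒m∸n≡0 n≤k)

P′-suc : ∀ n k → suc n P′ suc k ≡ suc n * (n P′ k)
P′-suc n k = nP′k≡n[n∸1P′k∸1] (suc n) (suc k)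

P′-step : ∀ n k → n * (n P′ k) ≡ n P′ suc k + k * (n P′ k)
P′-step n k with k ≤? n
... | yes k≤n = begin
  n * (n P′ k)                       ≡⟨ cong (_* (n P′ k)) (m∸n+n≡m k≤n) ⟨
  (n ∸ k + k) * (n P′ k)             ≡⟨ *-distribʳ-+ (n P′ k) (n ∸ k) k ⟩
  n P′ suc k + k * (n P′ k)          ∎
  where open ≡-Reasoning
... | no k≰n rewrite P′-zero (≰⇒> k≰n) = trans (*-zeroʳ n) (sym (cong₂ _+_ (*-zeroʳ (n ∸ k)) (*-zeroʳ k)))

C*!≡P′ : ∀ n k → (n C k) * k ! ≡ n P′ k
C*!≡P′ n k with k ≤? n
... | yes k≤n = begin
  (n C k) * k !                      ≡⟨ cong (_* k !) (nCk≡nPk/k! k≤n) ⟩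
  ((n ℕC.P k) / k !) {{k !≢0}} * k !    ≡⟨ m/n*n≡m {{k !≢0}} (subst (k ! ∣_) (sym P≡P′) (k!∣nP′k k≤n)) ⟩
  n ℕC.P k                              ≡⟨ P≡P′ ⟩
  n P′ k                             ∎
  where
  open ≡-Reasoning
  P≡P′ : n ℕC.P k ≡ n P′ k
  P≡P′ with k ≤ᵇ n | ≤⇒≤ᵇ k≤n
  ... | true | _ = refl
... | no k≰n = trans (cong (_* k !) (k>n⇒nCk≡0 (≰⇒> k≰n))) (sym (P′-zero (≰⇒> k≰n)))

C-absorb : ∀ n k → suc k * (suc n C suc k) ≡ suc n * (n C k)
C-absorb n k = *-cancelʳ-≡ _ _ (k !) {{k !≢0}} (begin
  suc k * (suc n C suc k) * k !      ≡⟨ solve 3 (λ a b c → a :* b :* c := b :* (a :* c)) refl (suc k) (suc n C suc k) (k !) ⟩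
  (suc n C suc k) * (suc k) !        ≡⟨ C*!≡P′ (suc n) (suc k) ⟩
  suc n P′ suc k                     ≡⟨ P′-suc n k ⟩
  suc n * (n P′ k)                   ≡⟨ cong (suc n *_) (C*!≡P′ n k) ⟨
  suc n * ((n C k) * k !)            ≡⟨ *-assoc (suc n) (n C k) (k !) ⟨
  suc n * (n C k) * k !              ∎)
  where open ≡-Reasoning

[m∸1]Ck*m*k!≡mP′[1+k] : ∀ m k → ((m ∸ 1) C k) * m * k ! ≡ m P′ suc k
[m∸1]Ck*m*k!≡mP′[1+k] zero    k = trans (cong (_* k !) (*-zeroʳ (0 C k))) (sym (cong (_* (0 P′ k)) (0∸n≡0 k)))
[m∸1]Ck*m*k!≡mP′[1+k] (suc m) k = begin
  (m C k) * suc m * k !              ≡⟨ *-right-comm (m C k) (suc m) (k !) ⟩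
  (m C k) * k ! * suc m              ≡⟨ cong (_* suc m) (C*!≡P′ m k) ⟩
  (m P′ k) * suc m                   ≡⟨ *-comm (m P′ k) (suc m) ⟩
  suc m * (m P′ k)                   ≡⟨ P′-suc m k ⟨
  suc m P′ suc k                     ∎
  where open ≡-Reasoning

P′-pos : ∀ {n k} → k ≤ n → 0 < n P′ k
P′-pos {n} {zero}  _   = s≤s z≤n
P′-pos {n} {suc k} k<n = *-mono-< (m<n⇒0<n∸m k<n) (P′-pos (<⇒≤ k<n))

C-pos : ∀ {n k} → k ≤ n → 0 < n C k
C-pos {n} {k} k≤n with n C k | C*!≡P′ n k
... | zero  | C*!≡0 = contradiction (subst (0 <_) (sym C*!≡0) (P′-pos k≤n)) (<-irrefl refl)
... | suc _ | _     = s≤s z≤n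

P′≤^ : ∀ n k → n P′ k ≤ n ^ k
P′≤^ n zero    = ≤-refl
P′≤^ n (suc k) = begin
  (n ∸ k) * (n P′ k)    ≤⟨ *-mono-≤ (m∸n≤m n k) (P′≤^ n k) ⟩
  n * n ^ k             ∎
  where open ≤-Reasoning

^*P′≤P′ : ∀ a n t → 1 ≤ a → a ^ t * (n P′ t) ≤ (a * n) P′ t
^*P′≤P′ a n zero    _   = ≤-refl
^*P′≤P′ a n (suc t) a≥1 = begin
  a * a ^ t * ((n ∸ t) * (n P′ t))
    ≡⟨ solve 4 (λ a p d f → a :* p :* (d :* f) := a :* d :* (p :* f)) refl a (a ^ t) (n ∸ t) (n P′ t) ⟩
  a * (n ∸ t) * (a ^ t * (n P′ t))
    ≤⟨ *-mono-≤ a[n∸t]≤an∸t (^*P′≤P′ a n t a≥1) ⟩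
  (a * n ∸ t) * ((a * n) P′ t)         ∎
  where
  open ≤-Reasoning
  a[n∸t]≤an∸t : a * (n ∸ t) ≤ a * n ∸ t
  a[n∸t]≤an∸t = begin
    a * (n ∸ t)      ≡⟨ *-distribˡ-∸ a n t ⟩
    a * n ∸ a * t    ≤⟨ ∸-monoʳ-≤ (a * n) (*-monoˡ-≤ t a≥1) ⟩
    a * n ∸ 1 * t    ≡⟨ cong (a * n ∸_) (*-identityˡ t) ⟩
    a * n ∸ t        ∎

P′-+ : ∀ n s t → n P′ (s + t) ≤ (n P′ s) * (n P′ t)
P′-+ n s zero    = ≤-reflexive (trans (cong (n P′_) (+-identityʳ s)) (sym (*-identityʳ (n P′ s))))
P′-+ n s (suc t) = begin
  n P′ (s + suc t)                     ≡⟨ cong (n P′_) (+-suc s t) ⟩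
  (n ∸ (s + t)) * (n P′ (s + t))       ≤⟨ *-mono-≤ (∸-monoʳ-≤ n (m≤n+m t s)) (P′-+ n s t) ⟩
  (n ∸ t) * ((n P′ s) * (n P′ t))        ≡⟨ x∙yz≈y∙xz (n ∸ t) (n P′ s) (n P′ t) ⟩
  (n P′ s) * ((n ∸ t) * (n P′ t))        ∎
  where open ≤-Reasoning

P′-∑ : ∀ {r} n (t : Fin r → ℕ) → n P′ ∑ t ≤ ∏ (λ s → n P′ t s)
P′-∑ {zero}  n t = ≤-refl
P′-∑ {suc r} n t = ≤-trans (P′-+ n (t zero) (∑ (t ∘ suc))) (*-monoʳ-≤ (n P′ t zero) (P′-∑ n (t ∘ suc)))

bernoulli : ∀ n k → n * n ^ k ≤ n * (n P′ k) + k * k * n ^ k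
bernoulli n zero    = ≤-reflexive (sym (+-identityʳ _))
bernoulli n (suc k) = begin
  n * (n * n ^ k)
    ≤⟨ *-monoʳ-≤ n (bernoulli n k) ⟩
  n * (n * (n P′ k) + k * k * n ^ k)
    ≡⟨ cong (λ z → n * (z + k * k * n ^ k)) (P′-step n k) ⟩
  n * (n P′ suc k + k * (n P′ k) + k * k * n ^ k)
    ≤⟨ *-monoʳ-≤ n (+-monoˡ-≤ (k * k * n ^ k) (+-monoʳ-≤ (n P′ suc k) (*-monoʳ-≤ k (P′≤^ n k)))) ⟩
  n * (n P′ suc k + k * n ^ k + k * k * n ^ k)
    ≡⟨ solve 4 (λ n f k p → n :* (f :+ k :* p :+ k :* k :* p) := n :* f :+ (k :+ k :* k) :* (n :* p)) refl n (n P′ suc k) k (n ^ k) ⟩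
  n * (n P′ suc k) + (k + k * k) * (n * n ^ k)
    ≤⟨ +-monoʳ-≤ (n * (n P′ suc k)) (*-monoˡ-≤ (n * n ^ k) k+k²≤[1+k]²) ⟩
  n * (n P′ suc k) + suc k * suc k * (n * n ^ k)         ∎
  where
  open ≤-Reasoning
  k+k²≤[1+k]² : k + k * k ≤ suc k * suc k
  k+k²≤[1+k]² = ≤-trans (m≤n+m (k + k * k) (suc k)) (≤-reflexive (solve 1 (λ k → (con 1 :+ k) :+ (k :+ k :* k) := (con 1 :+ k) :* (con 1 :+ k))
                                                                    refl k))

[krn∸1]C[k∸1]*n*r*k!≡krnP′k : ∀ k r n → 0 < k → ((k * r * n ∸ 1) C (k ∸ 1)) * n * r * k ! ≡ (k * r * n) P′ k
[krn∸1]C[k∸1]*n*r*k!≡krnP′k (suc k) r n _ = begin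
  ((m ∸ 1) C k) * n * r * (suc k * k !)
    ≡⟨ solve 5 (λ b n r k f → b :* n :* r :* (k :* f) := b :* (k :* r :* n) :* f) refl ((m ∸ 1) C k) n r (suc k) (k !) ⟩
  ((m ∸ 1) C k) * m * k !
    ≡⟨ [m∸1]Ck*m*k!≡mP′[1+k] m k ⟩
  m P′ suc k                                     ∎
  where
  open ≡-Reasoning
  m = suc k * r * n

power≤falling : ∀ M n k → 0 < n → suc M * (k * k) ≤ n → M * n ^ k ≤ suc M * (n P′ k)
power≤falling M n k n>0 big = *-cancelʳ-≤ (M * n ^ k) (suc M * (n P′ k)) n {{>-nonZero n>0}} (+-cancelʳ-≤ (n * n ^ k) _ _ (begin
  M * n ^ k * n + n * n ^ k
    ≡⟨ solve 3 (λ M n p → M :* p :* n :+ n :* p := (con 1 :+ M) :* (n :* p)) refl M n (n ^ k) ⟩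
  suc M * (n * n ^ k)
    ≤⟨ *-monoʳ-≤ (suc M) (bernoulli n k) ⟩
  suc M * (n * (n P′ k) + k * k * n ^ k)
    ≡⟨ solve 5 (λ M n f k p → (con 1 :+ M) :* (n :* f :+ k :* k :* p) := (con 1 :+ M) :* f :* n :+ (con 1 :+ M) :* (k :* k) :* p)
         refl M n (n P′ k) k (n ^ k) ⟩
  suc M * (n P′ k) * n + suc M * (k * k) * n ^ k
    ≤⟨ +-monoʳ-≤ (suc M * (n P′ k) * n) (*-monoˡ-≤ (n ^ k) big) ⟩
  suc M * (n P′ k) * n + n * n ^ k           ∎))
  where open ≤-Reasoning


-- Counting the sets of a given type in a partitioned vertex set

countᵇ-++ : ∀ {A : Set} (P : A → Bool) xs ys → countᵇ P (xs ++ ys) ≡ countᵇ P xs + countᵇ P ys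
countᵇ-++ P []       ys = refl
countᵇ-++ P (x ∷ xs) ys with P x
... | true  = cong suc (countᵇ-++ P xs ys)
... | false = countᵇ-++ P xs ys

countᵇ-map : ∀ {A B : Set} (P : B → Bool) (f : A → B) xs → countᵇ P (List.map f xs) ≡ countᵇ (P ∘ f) xs
countᵇ-map P f []       = refl
countᵇ-map P f (x ∷ xs) with P (f x)
... | true  = cong suc (countᵇ-map P f xs)
... | false = countᵇ-map P f xs

countᵇ-cong : ∀ {A : Set} {P Q : A → Bool} → (∀ x → P x ≡ Q x) → ∀ xs → countᵇ P xs ≡ countᵇ Q xs
countᵇ-cong P≗Q []       = refl
countᵇ-cong {Q = Q} P≗Q (x ∷ xs) rewrite P≗Q x with Q x
... | true  = cong suc (countᵇ-cong P≗Q xs)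
... | false = countᵇ-cong P≗Q xs

countᵇ-false : ∀ {A : Set} (xs : List A) → countᵇ (λ _ → false) xs ≡ 0
countᵇ-false []       = refl
countᵇ-false (x ∷ xs) = countᵇ-false xs

countᵇ-mono : ∀ {A : Set} {P Q : A → Bool} → (∀ x → P x ≡ true → Q x ≡ true) → ∀ xs → countᵇ P xs ≤ countᵇ Q xs
countᵇ-mono P⇒Q [] = z≤n
countᵇ-mono {P = P} {Q} P⇒Q (x ∷ xs) with P x in Px | Q x in Qx
... | true  | true  = s≤s (countᵇ-mono P⇒Q xs)
... | true  | false = contradiction (trans (sym (P⇒Q x Px)) Qx) λ ()
... | false | true  = m≤n⇒m≤1+n (countᵇ-mono P⇒Q xs)
... | false | false = countᵇ-mono P⇒Q xs

countᵇ-≤-length : ∀ {A : Set} (P : A → Bool) xs → countᵇ P xs ≤ List.length xs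
countᵇ-≤-length P []       = z≤n
countᵇ-≤-length P (x ∷ xs) with P x
... | true  = s≤s (countᵇ-≤-length P xs)
... | false = m≤n⇒m≤1+n (countᵇ-≤-length P xs)

countᵇ-∨ : ∀ {A : Set} (P Q : A → Bool) xs → countᵇ (λ x → P x ∨ Q x) xs ≤ countᵇ P xs + countᵇ Q xs
countᵇ-∨ P Q []       = z≤n
countᵇ-∨ P Q (x ∷ xs) with P x | Q x
... | true  | true  = s≤s (≤-trans (countᵇ-∨ P Q xs) (≤-trans (n≤1+n _) (≤-reflexive (sym (+-suc _ _)))))
... | true  | false = s≤s (countᵇ-∨ P Q xs)
... | false | true  = ≤-trans (s≤s (countᵇ-∨ P Q xs)) (≤-reflexive (sym (+-suc _ _)))
... | false | false = countᵇ-∨ P Q xs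

countᵇ-∨-disjoint : ∀ {A : Set} (P Q : A → Bool) xs → (∀ x → P x ≡ true → Q x ≡ true → ⊥) →
  countᵇ (λ x → P x ∨ Q x) xs ≡ countᵇ P xs + countᵇ Q xs
countᵇ-∨-disjoint P Q []       disj = refl
countᵇ-∨-disjoint P Q (x ∷ xs) disj with P x in Px | Q x in Qx
... | true  | true  = ⊥-elim (disj x Px Qx)
... | true  | false = cong suc (countᵇ-∨-disjoint P Q xs disj)
... | false | true  = trans (cong suc (countᵇ-∨-disjoint P Q xs disj)) (sym (+-suc _ _))
... | false | false = countᵇ-∨-disjoint P Q xs disj

anyᵇ : ∀ {r} → (Fin r → Bool) → Bool
anyᵇ = VF.foldr _∨_ false

does-any? : ∀ {r} {P : Fin r → Set} (P? : ∀ c → Dec (P c)) → does (any? P?) ≡ anyᵇ (does ∘ P?)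
does-any? {zero}  P? = refl
does-any? {suc r} P? = cong (does (P? zero) ∨_) (does-any? (P? ∘ suc))

anyᵇ-intro : ∀ {r} (f : Fin r → Bool) c → f c ≡ true → anyᵇ f ≡ true
anyᵇ-intro f zero    fc = cong (_∨ anyᵇ (f ∘ suc)) fc
anyᵇ-intro f (suc c) fc with f zero
... | true  = refl
... | false = anyᵇ-intro (f ∘ suc) c fc

anyᵇ-elim : ∀ {r} (f : Fin r → Bool) → anyᵇ f ≡ true → ∃ λ c → f c ≡ true
anyᵇ-elim {suc r} f any-f with f zero in f0
... | true  = zero , f0
... | false = let c , fc = anyᵇ-elim (f ∘ suc) any-f in suc c , fc

witness : ∀ {r} {P : Fin r → Set} → Dec (∃ P) → Maybe (Fin r)
witness (yes (c , _)) = just c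
witness (no _)        = nothing

witness-sound : ∀ {r} {P : Fin r → Set} {c} (d : Dec (∃ P)) → witness d ≡ just c → P c
witness-sound (yes (c , Pc)) refl = Pc

is-just-witness : ∀ {r} {P : Fin r → Set} (d : Dec (∃ P)) → is-just (witness d) ≡ does d
is-just-witness (yes _) = refl
is-just-witness (no _)  = refl

countᵇ-anyᵇ : ∀ {A : Set} {r} (Q : A → Bool) (P : Fin r → A → Bool) xs →
  countᵇ (λ x → Q x ∧ anyᵇ (λ c → P c x)) xs ≤ ∑ (λ c → countᵇ (λ x → Q x ∧ P c x) xs)
countᵇ-anyᵇ {r = zero}  Q P xs = ≤-reflexive (trans (countᵇ-cong (λ x → ∧-zeroʳ (Q x)) xs) (countᵇ-false xs))
countᵇ-anyᵇ {r = suc r} Q P xs = begin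
  countᵇ (λ x → Q x ∧ (P zero x ∨ anyᵇ (λ c → P (suc c) x))) xs
    ≡⟨ countᵇ-cong (λ x → ∧-distribˡ-∨ (Q x) (P zero x) _) xs ⟩
  countᵇ (λ x → Q x ∧ P zero x ∨ Q x ∧ anyᵇ (λ c → P (suc c) x)) xs
    ≤⟨ countᵇ-∨ (λ x → Q x ∧ P zero x) _ xs ⟩
  countᵇ (λ x → Q x ∧ P zero x) xs + countᵇ (λ x → Q x ∧ anyᵇ (λ c → P (suc c) x)) xs
    ≤⟨ +-monoʳ-≤ _ (countᵇ-anyᵇ Q (P ∘ suc) xs) ⟩
  ∑ (λ c → countᵇ (λ x → Q x ∧ P c x) xs) ∎
  where open ≤-Reasoning

countᵇ-anyᵇ-disjoint : ∀ {A : Set} {r} (Q : A → Bool) (P : Fin r → A → Bool) xs →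
  (∀ x {c c′} → P c x ≡ true → P c′ x ≡ true → c ≡ c′) →
  countᵇ (λ x → Q x ∧ anyᵇ (λ c → P c x)) xs ≡ ∑ (λ c → countᵇ (λ x → Q x ∧ P c x) xs)
countᵇ-anyᵇ-disjoint {r = zero}  Q P xs _ = trans (countᵇ-cong (λ x → ∧-zeroʳ (Q x)) xs) (countᵇ-false xs)
countᵇ-anyᵇ-disjoint {r = suc r} Q P xs disj = begin
  countᵇ (λ x → Q x ∧ (P zero x ∨ anyᵇ (λ c → P (suc c) x))) xs
    ≡⟨ countᵇ-cong (λ x → ∧-distribˡ-∨ (Q x) (P zero x) _) xs ⟩
  countᵇ (λ x → Q x ∧ P zero x ∨ Q x ∧ anyᵇ (λ c → P (suc c) x)) xs
    ≡⟨ countᵇ-∨-disjoint (λ x → Q x ∧ P zero x) _ xs zero-vs-suc ⟩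
  countᵇ (λ x → Q x ∧ P zero x) xs + countᵇ (λ x → Q x ∧ anyᵇ (λ c → P (suc c) x)) xs
    ≡⟨ cong (countᵇ (λ x → Q x ∧ P zero x) xs +_) (countᵇ-anyᵇ-disjoint Q (P ∘ suc) xs (λ x Pc Pc′ → FinP.suc-injective (disj x Pc Pc′))) ⟩
  ∑ (λ c → countᵇ (λ x → Q x ∧ P c x) xs) ∎
  where
  open ≡-Reasoning
  zero-vs-suc : ∀ x → Q x ∧ P zero x ≡ true → Q x ∧ anyᵇ (λ c → P (suc c) x) ≡ true → ⊥
  zero-vs-suc x Q∧P₀ Q∧Pₛ with Q x
  ... | true = let c , Pₛc = anyᵇ-elim (λ c → P (suc c) x) Q∧Pₛ in 0≢suc (disj x Q∧P₀ Pₛc)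
    where
    0≢suc : ∀ {c : Fin r} → ¬ zero ≡ suc c
    0≢suc ()

length-allSubsets : ∀ N → List.length (allSubsets N) ≡ 2 ^ N
length-allSubsets zero    = refl
length-allSubsets (suc N) = begin
  List.length (List.map (outside ∷_) (allSubsets N) ++ List.map (inside ∷_) (allSubsets N))
    ≡⟨ length-++ (List.map (outside ∷_) (allSubsets N)) ⟩
  List.length (List.map (outside ∷_) (allSubsets N)) + List.length (List.map (inside ∷_) (allSubsets N))
    ≡⟨ cong₂ _+_ (length-map (outside ∷_) (allSubsets N)) (length-map (inside ∷_) (allSubsets N)) ⟩
  List.length (allSubsets N) + List.length (allSubsets N)
    ≡⟨ cong₂ _+_ (length-allSubsets N) (trans (length-allSubsets N) (sym (*-identityˡ (2 ^ N)))) ⟩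
  2 ^ suc N ∎
  where open ≡-Reasoning

countᵇ-allSubsets-suc : ∀ {N} (P : Subset (suc N) → Bool) →
  countᵇ P (allSubsets (suc N)) ≡ countᵇ (P ∘ (outside ∷_)) (allSubsets N) + countᵇ (P ∘ (inside ∷_)) (allSubsets N)
countᵇ-allSubsets-suc {N} P = trans (countᵇ-++ P (List.map (outside ∷_) (allSubsets N)) _)
  (cong₂ _+_ (countᵇ-map P (outside ∷_) (allSubsets N)) (countᵇ-map P (inside ∷_) (allSubsets N)))

module _ {N r : ℕ} where

  typeOf : (Fin N → Fin r) → Subset N → Fin r → ℕ
  typeOf p e i = ∣ e ∩ partSet p i ∣

  partSize : (Fin N → Fin r) → Fin r → ℕ
  partSize p i = ∣ partSet p i ∣

  ofType : (Fin N → Fin r) → (Fin r → ℕ) → Subset N → Bool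
  ofType p t e = does (all? (λ i → typeOf p e i ≟ t i))

  #ofType : (Fin N → Fin r) → (Fin r → ℕ) → ℕ
  #ofType p t = countᵇ (ofType p t) (allSubsets N)

  #ofType∋ : (Fin N → Fin r) → Fin N → (Fin r → ℕ) → ℕ
  #ofType∋ p v t = countᵇ (λ e → lookup e v ∧ ofType p t e) (allSubsets N)

-- The type t − e_c; the subtraction is truncated, but only applied where t c ≥ 1.
lowerAt : ∀ {r} → Fin r → (Fin r → ℕ) → Fin r → ℕ
lowerAt c t i = t i ∸ δ c i

∣∷∣ : ∀ {N} x (xs : Subset N) → ∣ x ∷ xs ∣ ≡ (if x then 1 else 0) + ∣ xs ∣
∣∷∣ true  xs = refl
∣∷∣ false xs = refl

ofType-sound : ∀ {N r} (p : Fin N → Fin r) t e → ofType p t e ≡ true → ∀ i → typeOf p e i ≡ t i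
ofType-sound p t e = from-does (all? (λ i → typeOf p e i ≟ t i))
  where
  from-does : ∀ {A : Set} (a? : Dec A) → does a? ≡ true → A
  from-does (yes a) _ = a

ofType-complete : ∀ {N r} (p : Fin N → Fin r) t e → (∀ i → typeOf p e i ≡ t i) → ofType p t e ≡ true
ofType-complete p t e = dec-true (all? (λ i → typeOf p e i ≟ t i))

module _ {N r} (p : Fin (suc N) → Fin r) where

  private
    c  = p zero
    p′ = p ∘ suc

  typeOf-inside : ∀ e i → typeOf p (inside ∷ e) i ≡ δ c i + typeOf p′ e i
  typeOf-inside e i = ∣∷∣ ⌊ c Fin.≟ i ⌋ (e ∩ partSet p′ i)

  partSize-suc : ∀ i → partSize p i ≡ δ c i + partSize p′ i
  partSize-suc i = ∣∷∣ ⌊ c Fin.≟ i ⌋ (partSet p′ i)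

  partSize-here : partSize p c ≡ suc (partSize p′ c)
  partSize-here = trans (partSize-suc c) (cong (_+ partSize p′ c) (δ-diag c))

  partSize-off : ∀ {s} → c ≢ s → partSize p s ≡ partSize p′ s
  partSize-off c≢s = trans (partSize-suc _) (cong (_+ partSize p′ _) (δ-off c≢s))

  ofType-inside-zero : ∀ {t} e → t c ≡ 0 → ofType p t (inside ∷ e) ≡ false
  ofType-inside-zero {t} e tc≡0 = dec-false (all? _) λ same → 0≢1+n
      (trans (sym tc≡0) (trans (sym (same c)) (trans (typeOf-inside e c) (cong (_+ typeOf p′ e c) (δ-diag c)))))

  ofType-inside-suc : ∀ {t m} e → t c ≡ suc m → ofType p t (inside ∷ e) ≡ ofType p′ (lowerAt c t) e
  ofType-inside-suc {t} e tc≡1+m = does-⇔ (mk⇔ to from) (all? _) (all? _)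
    where
    δ≤t : ∀ i → δ c i ≤ t i
    δ≤t i with c Fin.≟ i
    ... | yes refl = subst (1 ≤_) (sym tc≡1+m) (s≤s z≤n)
    ... | no _     = z≤n
    to : (∀ i → typeOf p (inside ∷ e) i ≡ t i) → ∀ i → typeOf p′ e i ≡ lowerAt c t i
    to same i = trans (sym (m+n∸m≡n (δ c i) _)) (cong (_∸ δ c i) (trans (sym (typeOf-inside e i)) (same i)))
    from : (∀ i → typeOf p′ e i ≡ lowerAt c t i) → ∀ i → typeOf p (inside ∷ e) i ≡ t i
    from same i = trans (typeOf-inside e i) (trans (cong (δ c i +_) (same i)) (m+[n∸m]≡n (δ≤t i)))

#ofType-empty : ∀ {r} (t : Fin r → ℕ) (t≡0? : Dec (∀ i → 0 ≡ t i)) → (if does t≡0? then 1 else 0) ≡ ∏ (λ s → 0 C t s)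
#ofType-empty {r} t (yes t≡0) = sym (trans (∏-cong (λ s → cong (0 C_) (sym (t≡0 s)))) (∏ℕ.sum-replicate-zero r))
#ofType-empty t (no t≢0)  = sym (∏-zero-at i _ (k>n⇒nCk≡0 (n≢0⇒n>0 (0≢ti ∘ sym))))
  where
  i = proj₁ (¬∀⟶∃¬ _ _ (λ i → 0 ≟ t i) t≢0)
  0≢ti = proj₂ (¬∀⟶∃¬ _ _ (λ i → 0 ≟ t i) t≢0)

#ofType-closed : ∀ {N r} (p : Fin N → Fin r) t → #ofType p t ≡ ∏ (λ s → partSize p s C t s)
#ofType-closed {zero}  p t = #ofType-empty t (all? _)
#ofType-closed {suc N} p t with t (p zero) in tc
... | zero  = begin
  #ofType p t
    ≡⟨ countᵇ-allSubsets-suc (ofType p t) ⟩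
  #ofType p′ t + countᵇ (ofType p t ∘ (inside ∷_)) (allSubsets N)
    ≡⟨ cong₂ _+_ (#ofType-closed p′ t) (trans (countᵇ-cong (λ e → ofType-inside-zero p e tc) (allSubsets N)) (countᵇ-false (allSubsets N))) ⟩
  ∏ (λ s → partSize p′ s C t s) + 0
    ≡⟨ +-identityʳ _ ⟩
  ∏ (λ s → partSize p′ s C t s)
    ≡⟨ ∏-cong factor ⟩
  ∏ (λ s → partSize p s C t s)                                         ∎
  where
  open ≡-Reasoning
  p′ = p ∘ suc
  factor : ∀ s → partSize p′ s C t s ≡ partSize p s C t s
  factor = cases-at (p zero) (trans (cong (partSize p′ (p zero) C_) tc) (sym (cong (partSize p (p zero) C_) tc)))
      (λ c≢s → cong (_C t _) (sym (partSize-off p c≢s)))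
... | suc m = begin
  #ofType p t
    ≡⟨ countᵇ-allSubsets-suc (ofType p t) ⟩
  #ofType p′ t + countᵇ (ofType p t ∘ (inside ∷_)) (allSubsets N)
    ≡⟨ cong (#ofType p′ t +_) (countᵇ-cong (λ e → ofType-inside-suc p e tc) (allSubsets N)) ⟩
  #ofType p′ t + #ofType p′ (lowerAt c t)
    ≡⟨ cong₂ _+_ (#ofType-closed p′ t) (#ofType-closed p′ (lowerAt c t)) ⟩
  ∏ (λ s → partSize p′ s C t s) + ∏ (λ s → partSize p′ s C lowerAt c t s)
    ≡⟨ ∏-+-at c (λ s c≢s → cong (_C t s) (partSize-off p c≢s)) (λ s c≢s → cong₂ _C_ (partSize-off p c≢s) (sym (lowerAt-off c≢s))) pascal ⟨
  ∏ (λ s → partSize p s C t s)                                         ∎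
  where
  open ≡-Reasoning
  c  = p zero
  p′ = p ∘ suc
  lowerAt-off : ∀ {s} → c ≢ s → lowerAt c t s ≡ t s
  lowerAt-off c≢s = cong (t _ ∸_) (δ-off c≢s)
  pascal : partSize p c C t c ≡ partSize p′ c C t c + partSize p′ c C lowerAt c t c
  pascal = begin
    partSize p c C t c
      ≡⟨ cong₂ _C_ (partSize-here p) tc ⟩
    suc (partSize p′ c) C suc m
      ≡⟨ nCk+nC[k+1]≡[n+1]C[k+1] (partSize p′ c) m ⟨
    partSize p′ c C m + partSize p′ c C suc m
      ≡⟨ +-comm (partSize p′ c C m) _ ⟩
    partSize p′ c C suc m + partSize p′ c C m
      ≡⟨ cong₂ (λ x y → partSize p′ c C x + partSize p′ c C y) (sym tc) (sym (cong₂ _∸_ tc (δ-diag c))) ⟩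
    partSize p′ c C t c + partSize p′ c C lowerAt c t c     ∎

-- The number of t-subsets of an m-set that contain a given point.
_C∋_ : ℕ → ℕ → ℕ
m C∋ zero  = 0
m C∋ suc t = pred m C t

C∋-absorb : ∀ m t → (m C∋ t) * m ≡ (m C t) * t
C∋-absorb m       zero    = sym (*-zeroʳ (m C 0))
C∋-absorb zero    (suc t) = *-zeroʳ (0 C t)
C∋-absorb (suc m) (suc t) = trans (*-comm (m C t) (suc m)) (trans (sym (C-absorb m t)) (*-comm (suc t) _))

C∋-pascal : ∀ w m → 1 ≤ w → suc w C∋ suc m ≡ w C∋ suc m + w C∋ m
C∋-pascal (suc w) zero    _ = refl
C∋-pascal (suc w) (suc m) _ = sym (trans (+-comm (w C suc m) (w C m)) (nCk+nC[k+1]≡[n+1]C[k+1] w m))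

-- The factor of part s in the number of sets of a given type through a vertex of part l.
chooseAt : ∀ {r} → Fin r → Fin r → ℕ → ℕ → ℕ
chooseAt l s = if ⌊ l Fin.≟ s ⌋ then _C∋_ else _C_

chooseAt-here : ∀ {r} (l : Fin r) m t → chooseAt l l m t ≡ m C∋ t
chooseAt-here l m t with l Fin.≟ l
... | yes _   = refl
... | no l≢l  = ⊥-elim (l≢l refl)

chooseAt-off : ∀ {r} {l s : Fin r} m t → l ≢ s → chooseAt l s m t ≡ m C t
chooseAt-off {l = l} {s} m t l≢s with l Fin.≟ s
... | yes l≡s = ⊥-elim (l≢s l≡s)
... | no _    = refl

chooseAt-none : ∀ {r} (l s : Fin r) m m′ → chooseAt l s m 0 ≡ chooseAt l s m′ 0
chooseAt-none l s m m′ with ⌊ l Fin.≟ s ⌋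
... | true  = refl
... | false = refl

chooseAt-pascal : ∀ {r} (l c : Fin r) w m → (l ≡ c → 1 ≤ w) →
  chooseAt l c (suc w) (suc m) ≡ chooseAt l c w (suc m) + chooseAt l c w m
chooseAt-pascal l c w m w>0 with l Fin.≟ c
... | yes l≡c = C∋-pascal w m (w>0 l≡c)
... | no _    = sym (trans (+-comm (w C suc m) (w C m)) (nCk+nC[k+1]≡[n+1]C[k+1] w m))

partSize-pos : ∀ {N r} (p : Fin N → Fin r) v → 1 ≤ partSize p (p v)
partSize-pos p zero    = subst (1 ≤_) (sym (partSize-here p)) (s≤s z≤n)
partSize-pos p (suc v) = ≤-trans (partSize-pos (p ∘ suc) v)
    (≤-trans (m≤n+m _ (δ (p zero) (p (suc v)))) (≤-reflexive (sym (partSize-suc p (p (suc v))))))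

#ofType∋-closed : ∀ {N r} (p : Fin N → Fin r) v t → #ofType∋ p v t ≡ ∏ (λ s → chooseAt (p v) s (partSize p s) (t s))
#ofType∋-closed {suc N} p v t with t (p zero) in tc
#ofType∋-closed {suc N} p zero t | zero = begin
  #ofType∋ p zero t
    ≡⟨ countᵇ-allSubsets-suc (λ e → lookup e zero ∧ ofType p t e) ⟩
  countᵇ (λ _ → false) (allSubsets N) + countᵇ (ofType p t ∘ (inside ∷_)) (allSubsets N)
    ≡⟨ cong₂ _+_ (countᵇ-false (allSubsets N)) (trans (countᵇ-cong (λ e → ofType-inside-zero p e tc) (allSubsets N)) (countᵇ-false (allSubsets N))) ⟩
  0
    ≡⟨ ∏-zero-at (p zero) _ (trans (chooseAt-here (p zero) _ _) (cong (_ C∋_) tc)) ⟨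
  ∏ (λ s → chooseAt (p zero) s (partSize p s) (t s))               ∎
  where open ≡-Reasoning
#ofType∋-closed {suc N} p zero t | suc m = begin
  #ofType∋ p zero t
    ≡⟨ countᵇ-allSubsets-suc (λ e → lookup e zero ∧ ofType p t e) ⟩
  countᵇ (λ _ → false) (allSubsets N) + countᵇ (ofType p t ∘ (inside ∷_)) (allSubsets N)
    ≡⟨ cong₂ _+_ (countᵇ-false (allSubsets N)) (countᵇ-cong (λ e → ofType-inside-suc p e tc) (allSubsets N)) ⟩
  #ofType (p ∘ suc) (lowerAt c t)
    ≡⟨ #ofType-closed (p ∘ suc) (lowerAt c t) ⟩
  ∏ (λ s → partSize (p ∘ suc) s C lowerAt c t s)
    ≡⟨ ∏-cong (cases-at c at-c off) ⟩
  ∏ (λ s → chooseAt c s (partSize p s) (t s))                      ∎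
  where
  open ≡-Reasoning
  c = p zero
  at-c : partSize (p ∘ suc) c C lowerAt c t c ≡ chooseAt c c (partSize p c) (t c)
  at-c = trans (cong (partSize (p ∘ suc) c C_) (cong₂ _∸_ tc (δ-diag c))) (sym (trans (chooseAt-here c _ _) (cong₂ _C∋_ (partSize-here p) tc)))
  off : ∀ {s} → c ≢ s → partSize (p ∘ suc) s C lowerAt c t s ≡ chooseAt c s (partSize p s) (t s)
  off c≢s = sym (trans (chooseAt-off _ _ c≢s) (cong₂ _C_ (partSize-off p c≢s) (sym (cong (t _ ∸_) (δ-off c≢s)))))
#ofType∋-closed {suc N} p (suc v) t | zero = begin
  #ofType∋ p (suc v) t
    ≡⟨ countᵇ-allSubsets-suc (λ e → lookup e (suc v) ∧ ofType p t e) ⟩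
  #ofType∋ p′ v t + countᵇ (λ e → lookup e v ∧ ofType p t (inside ∷ e)) (allSubsets N)
    ≡⟨ cong₂ _+_ (#ofType∋-closed p′ v t)
         (trans (countᵇ-cong (λ e → trans (cong (lookup e v ∧_) (ofType-inside-zero p e tc)) (∧-zeroʳ (lookup e v))) (allSubsets N))
             (countᵇ-false (allSubsets N))) ⟩
  ∏ (λ s → chooseAt l s (partSize p′ s) (t s)) + 0
    ≡⟨ +-identityʳ _ ⟩
  ∏ (λ s → chooseAt l s (partSize p′ s) (t s))
    ≡⟨ ∏-cong (cases-at c at-c off) ⟩
  ∏ (λ s → chooseAt l s (partSize p s) (t s))                      ∎
  where
  open ≡-Reasoning
  c  = p zero
  p′ = p ∘ suc
  l  = p (suc v)
  at-c : chooseAt l c (partSize p′ c) (t c) ≡ chooseAt l c (partSize p c) (t c)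
  at-c = trans (cong (chooseAt l c _) tc) (trans (chooseAt-none l c _ _) (cong (chooseAt l c _) (sym tc)))
  off : ∀ {s} → c ≢ s → chooseAt l s (partSize p′ s) (t s) ≡ chooseAt l s (partSize p s) (t s)
  off c≢s = cong (λ x → chooseAt l _ x (t _)) (sym (partSize-off p c≢s))
#ofType∋-closed {suc N} p (suc v) t | suc m = begin
  #ofType∋ p (suc v) t
    ≡⟨ countᵇ-allSubsets-suc (λ e → lookup e (suc v) ∧ ofType p t e) ⟩
  #ofType∋ p′ v t + countᵇ (λ e → lookup e v ∧ ofType p t (inside ∷ e)) (allSubsets N)
    ≡⟨ cong (#ofType∋ p′ v t +_) (countᵇ-cong (λ e → cong (lookup e v ∧_) (ofType-inside-suc p e tc)) (allSubsets N)) ⟩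
  #ofType∋ p′ v t + #ofType∋ p′ v (lowerAt c t)
    ≡⟨ cong₂ _+_ (#ofType∋-closed p′ v t) (#ofType∋-closed p′ v (lowerAt c t)) ⟩
  ∏ (λ s → chooseAt l s (partSize p′ s) (t s)) + ∏ (λ s → chooseAt l s (partSize p′ s) (lowerAt c t s))
    ≡⟨ ∏-+-at c (λ s c≢s → cong (λ x → chooseAt l s x (t s)) (partSize-off p c≢s))
                (λ s c≢s → cong₂ (chooseAt l s) (partSize-off p c≢s) (sym (cong (t s ∸_) (δ-off c≢s)))) at-c ⟨
  ∏ (λ s → chooseAt l s (partSize p s) (t s))                      ∎
  where
  open ≡-Reasoning
  c  = p zero
  p′ = p ∘ suc
  l  = p (suc v)
  at-c : chooseAt l c (partSize p c) (t c) ≡ chooseAt l c (partSize p′ c) (t c) + chooseAt l c (partSize p′ c) (lowerAt c t c)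
  at-c = begin
    chooseAt l c (partSize p c) (t c)
      ≡⟨ cong₂ (chooseAt l c) (partSize-here p) tc ⟩
    chooseAt l c (suc (partSize p′ c)) (suc m)
      ≡⟨ chooseAt-pascal l c _ m (λ l≡c → subst (λ i → 1 ≤ partSize p′ i) l≡c (partSize-pos p′ v)) ⟩
    chooseAt l c (partSize p′ c) (suc m) + chooseAt l c (partSize p′ c) m
      ≡⟨ cong₂ (λ x y → chooseAt l c (partSize p′ c) x + chooseAt l c (partSize p′ c) y) (sym tc) (sym (cong₂ _∸_ tc (δ-diag c))) ⟩
    chooseAt l c (partSize p′ c) (t c) + chooseAt l c (partSize p′ c) (lowerAt c t c) ∎

#ofType∋-* : ∀ {N r} (p : Fin N → Fin r) v t → #ofType∋ p v t * partSize p (p v) ≡ #ofType p t * t (p v)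
#ofType∋-* p v t = begin
  #ofType∋ p v t * partSize p (p v)
    ≡⟨ cong (_* partSize p (p v)) (#ofType∋-closed p v t) ⟩
  ∏ (λ s → chooseAt (p v) s (partSize p s) (t s)) * partSize p (p v)
    ≡⟨ ∏-scale-at (p v) (λ s l≢s → chooseAt-off _ _ l≢s) at-l ⟩
  ∏ (λ s → partSize p s C t s) * t (p v)
    ≡⟨ cong (_* t (p v)) (#ofType-closed p t) ⟨
  #ofType p t * t (p v)                                              ∎
  where
  open ≡-Reasoning
  at-l : chooseAt (p v) (p v) (partSize p (p v)) (t (p v)) * partSize p (p v) ≡ (partSize p (p v) C t (p v)) * t (p v)
  at-l = trans (cong (_* partSize p (p v)) (chooseAt-here (p v) _ _)) (C∋-absorb (partSize p (p v)) (t (p v)))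

∣∣≡∑typeOf : ∀ {N r} (p : Fin N → Fin r) (e : Subset N) → ∣ e ∣ ≡ ∑ (typeOf p e)
∣∣≡∑typeOf {zero}  {r} p []          = sym (∑ℕ.sum-replicate-zero r)
∣∣≡∑typeOf {suc N} p (false ∷ e) = ∣∣≡∑typeOf (p ∘ suc) e
∣∣≡∑typeOf {suc N} p (true ∷ e)  = begin
  suc ∣ e ∣                                             ≡⟨ cong suc (∣∣≡∑typeOf (p ∘ suc) e) ⟩
  1 + ∑ (typeOf (p ∘ suc) e)                            ≡⟨ cong (_+ ∑ (typeOf (p ∘ suc) e)) (∑-δ (p zero)) ⟨
  ∑ (δ (p zero)) + ∑ (typeOf (p ∘ suc) e)               ≡⟨ ∑-distrib-+ (δ (p zero)) (typeOf (p ∘ suc) e) ⟨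
  ∑ (λ i → δ (p zero) i + typeOf (p ∘ suc) e i)         ≡⟨ ∑-cong (typeOf-inside p e) ⟨
  ∑ (typeOf p (inside ∷ e))                             ∎
  where open ≡-Reasoning

vertex-in-part : ∀ {N r} (p : Fin N → Fin r) l → 1 ≤ partSize p l → ∃ λ v → p v ≡ l
vertex-in-part {suc N} p l part≢∅ = search (p zero Fin.≟ l)
  where
  search : Dec (p zero ≡ l) → ∃ λ v → p v ≡ l
  search (yes p0≡l) = zero , p0≡l
  search (no p0≢l)  = let v , pv≡l = vertex-in-part (p ∘ suc) l (subst (1 ≤_) (partSize-off p p0≢l) part≢∅) in suc v , pv≡l

module _ {r : ℕ} where

  partSize-lookup-++ : ∀ {a b} (xs : Vec (Fin r) a) (ys : Vec (Fin r) b) i →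
    partSize (lookup (xs Vec.++ ys)) i ≡ partSize (lookup xs) i + partSize (lookup ys) i
  partSize-lookup-++ []       ys i = refl
  partSize-lookup-++ (x ∷ xs) ys i = trans (partSize-suc (lookup (x ∷ xs Vec.++ ys)) i)
    (trans (cong (δ x i +_) (partSize-lookup-++ xs ys i))
        (sym (trans (cong (_+ partSize (lookup ys) i) (partSize-suc (lookup (x ∷ xs)) i)) (+-assoc (δ x i) _ _))))

  partSize-lookup-replicate : ∀ n (c : Fin r) i → partSize (lookup (Vec.replicate n c)) i ≡ n * δ c i
  partSize-lookup-replicate zero    c i = refl
  partSize-lookup-replicate (suc n) c i = trans (partSize-suc (lookup (Vec.replicate (suc n) c)) i)
      (cong (δ c i +_) (partSize-lookup-replicate n c i))

  partSize-lookup-map-suc-zero : ∀ {a} (ys : Vec (Fin r) a) → partSize (lookup (Vec.map suc ys)) zero ≡ 0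
  partSize-lookup-map-suc-zero []       = refl
  partSize-lookup-map-suc-zero (y ∷ ys) = partSize-lookup-map-suc-zero ys

  partSize-lookup-map-suc : ∀ {a} (ys : Vec (Fin r) a) i → partSize (lookup (Vec.map suc ys)) (suc i) ≡ partSize (lookup ys) i
  partSize-lookup-map-suc []       i = refl
  partSize-lookup-map-suc (y ∷ ys) i = trans (partSize-suc (lookup (Vec.map suc (y ∷ ys))) (suc i))
    (trans (cong₂ _+_ (δ-suc y i) (partSize-lookup-map-suc ys i)) (sym (partSize-suc (lookup (y ∷ ys)) i)))

blocks : ∀ {r} (m : Fin r → ℕ) → Vec (Fin r) (∑ m)
blocks {zero}  m = []
blocks {suc r} m = Vec.replicate (m zero) zero Vec.++ Vec.map suc (blocks (m ∘ suc))

partSize-blocks : ∀ {r} (m : Fin r → ℕ) i → partSize (lookup (blocks m)) i ≡ m i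
partSize-blocks {suc r} m i = trans (partSize-lookup-++ (Vec.replicate (m zero) zero) (Vec.map suc (blocks (m ∘ suc))) i)
  (trans (cong (_+ partSize (lookup (Vec.map suc (blocks (m ∘ suc)))) i) (partSize-lookup-replicate (m zero) zero i)) (by-index i))
  where
  by-index : ∀ i → m zero * δ zero i + partSize (lookup (Vec.map suc (blocks (m ∘ suc)))) i ≡ m i
  by-index zero    = trans (cong₂ _+_ (*-identityʳ (m zero)) (partSize-lookup-map-suc-zero (blocks (m ∘ suc)))) (+-identityʳ (m zero))
  by-index (suc i) = cong₂ _+_ (*-zeroʳ (m zero)) (trans (partSize-lookup-map-suc (blocks (m ∘ suc)) i) (partSize-blocks (m ∘ suc) i))

partition-with-sizes : ∀ {N r} (m : Fin r → ℕ) → ∑ m ≡ N → Σ (Fin N → Fin r) λ p → ∀ i → partSize p i ≡ m i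
partition-with-sizes m refl = lookup (blocks m) , partSize-blocks m

module _ {k r N} (H : ColHG k r N) where

  private
    minDeg : List (Fin N) → ℕ
    minDeg = List.foldr (λ v m → deg H v ⊓ m) (2 ^ N)

    minDeg-≤ : ∀ {v} xs → v ∈ xs → minDeg xs ≤ deg H v
    minDeg-≤ (x ∷ xs) (here refl) = m⊓n≤m (deg H x) _
    minDeg-≤ (x ∷ xs) (there v∈xs) = ≤-trans (m⊓n≤n (deg H x) _) (minDeg-≤ xs v∈xs)

    minDeg-value : ∀ xs → minDeg xs ≡ 2 ^ N ⊎ ∃ λ v → minDeg xs ≡ deg H v
    minDeg-value []       = inj₁ refl
    minDeg-value (x ∷ xs) with ⊓-sel (deg H x) (minDeg xs)
    ... | inj₁ ≡deg = inj₂ (x , ≡deg)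
    ... | inj₂ ≡min = Sum.map (trans ≡min) (Product.map₂ (trans ≡min)) (minDeg-value xs)

  δ₁≤deg : ∀ v → δ₁ H ≤ deg H v
  δ₁≤deg v = minDeg-≤ (List.allFin N) (∈-allFin v)

  δ₁-value : δ₁ H ≡ 2 ^ N ⊎ ∃ λ v → δ₁ H ≡ deg H v
  δ₁-value = minDeg-value (List.allFin N)

deg≤2^N : ∀ {k r N} (H : ColHG k r N) v → deg H v ≤ 2 ^ N
deg≤2^N {N = N} H v = ≤-trans (countᵇ-≤-length _ (allSubsets N)) (≤-reflexive (length-allSubsets N))


private
  module ≃-Reasoning = SetoidReasoning ℚᵘP.≃-setoid

  toℚᵘ-ℤ→ℚ : ∀ z → toℚᵘ (ℤ→ℚ z) ℚᵘ.≃ mkℚᵘ z 0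
  toℚᵘ-ℤ→ℚ z = ℚP.toℚᵘ-fromℚᵘ (mkℚᵘ z 0)

ℤ→ℚ-homo-* : ∀ x y → ℤ→ℚ (x ℤ.* y) ≡ ℤ→ℚ x ℚ.* ℤ→ℚ y
ℤ→ℚ-homo-* x y = ℚP.toℚᵘ-injective (begin
  toℚᵘ (ℤ→ℚ (x ℤ.* y))               ≈⟨ toℚᵘ-ℤ→ℚ (x ℤ.* y) ⟩
  mkℚᵘ (x ℤ.* y) 0                   ≈⟨ ℚᵘP.*-cong (toℚᵘ-ℤ→ℚ x) (toℚᵘ-ℤ→ℚ y) ⟨
  toℚᵘ (ℤ→ℚ x) ℚᵘ.* toℚᵘ (ℤ→ℚ y)     ≈⟨ ℚP.toℚᵘ-homo-* (ℤ→ℚ x) (ℤ→ℚ y) ⟨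
  toℚᵘ (ℤ→ℚ x ℚ.* ℤ→ℚ y)             ∎)
  where open ≃-Reasoning

ℤ→ℚ-homo-+ : ∀ x y → ℤ→ℚ (x ℤ.+ y) ≡ ℤ→ℚ x ℚ.+ ℤ→ℚ y
ℤ→ℚ-homo-+ x y = ℚP.toℚᵘ-injective (begin
  toℚᵘ (ℤ→ℚ (x ℤ.+ y))
    ≈⟨ toℚᵘ-ℤ→ℚ (x ℤ.+ y) ⟩
  mkℚᵘ (x ℤ.+ y) 0
    ≈⟨ *≡* (cong (ℤ._* ℤ.1ℤ) (cong₂ ℤ._+_ (sym (ℤP.*-identityʳ x)) (sym (ℤP.*-identityʳ y)))) ⟩
  mkℚᵘ x 0 ℚᵘ.+ mkℚᵘ y 0
    ≈⟨ ℚᵘP.+-cong (toℚᵘ-ℤ→ℚ x) (toℚᵘ-ℤ→ℚ y) ⟨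
  toℚᵘ (ℤ→ℚ x) ℚᵘ.+ toℚᵘ (ℤ→ℚ y)
    ≈⟨ ℚP.toℚᵘ-homo-+ (ℤ→ℚ x) (ℤ→ℚ y) ⟨
  toℚᵘ (ℤ→ℚ x ℚ.+ ℤ→ℚ y)             ∎)
  where open ≃-Reasoning

ℤ→ℚ-homo-neg : ∀ x → ℤ→ℚ (ℤ.- x) ≡ ℚ.- ℤ→ℚ x
ℤ→ℚ-homo-neg x = ℚP.toℚᵘ-injective (begin
  toℚᵘ (ℤ→ℚ (ℤ.- x))                 ≈⟨ toℚᵘ-ℤ→ℚ (ℤ.- x) ⟩
  mkℚᵘ (ℤ.- x) 0                     ≈⟨ ℚᵘP.-‿cong (toℚᵘ-ℤ→ℚ x) ⟨
  ℚᵘ.- toℚᵘ (ℤ→ℚ x)                  ≈⟨ ℚP.toℚᵘ-homo‿- (ℤ→ℚ x) ⟨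
  toℚᵘ (ℚ.- ℤ→ℚ x)                   ∎)
  where open ≃-Reasoning

ℕ→ℚ-homo-* : ∀ x y → ℕ→ℚ (x * y) ≡ ℕ→ℚ x ℚ.* ℕ→ℚ y
ℕ→ℚ-homo-* x y = trans (cong ℤ→ℚ (ℤP.pos-* x y)) (ℤ→ℚ-homo-* (ℤ.+ x) (ℤ.+ y))

ℕ→ℚ-homo-+ : ∀ x y → ℕ→ℚ (x + y) ≡ ℕ→ℚ x ℚ.+ ℕ→ℚ y
ℕ→ℚ-homo-+ x y = ℤ→ℚ-homo-+ (ℤ.+ x) (ℤ.+ y)

ℕ→ℚ-mono-≤ : ∀ {x y} → x ≤ y → ℕ→ℚ x ℚ.≤ ℕ→ℚ y
ℕ→ℚ-mono-≤ {x} {y} x≤y = ℚP.toℚᵘ-cancel-≤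
  (ℚᵘP.≤-respˡ-≃ (ℚᵘP.≃-sym (toℚᵘ-ℤ→ℚ (ℤ.+ x))) (ℚᵘP.≤-respʳ-≃ (ℚᵘP.≃-sym (toℚᵘ-ℤ→ℚ (ℤ.+ y)))
    (ℚᵘ.*≤* (ℤP.*-monoʳ-≤-nonNeg (ℤ.+ 1) (ℤ.+≤+ x≤y)))))

ℕ→ℚ-cancel-≤ : ∀ {x y} → ℕ→ℚ x ℚ.≤ ℕ→ℚ y → x ≤ y
ℕ→ℚ-cancel-≤ {x} {y} x≤y with ℚᵘP.≤-respˡ-≃ (toℚᵘ-ℤ→ℚ (ℤ.+ x)) (ℚᵘP.≤-respʳ-≃ (toℚᵘ-ℤ→ℚ (ℤ.+ y)) (ℚP.toℚᵘ-mono-≤ x≤y))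
... | ℚᵘ.*≤* x*1≤y*1 = ℤP.drop‿+≤+ (subst₂ ℤ._≤_ (ℤP.*-identityʳ (ℤ.+ x)) (ℤP.*-identityʳ (ℤ.+ y)) x*1≤y*1)

ℕ→ℚ-positive : ∀ {x} → 0 < x → ℚ.Positive (ℕ→ℚ x)
ℕ→ℚ-positive {suc x} _ = ℚP.normalize-pos (suc x) 1

ℕ→ℚ≢0 : ∀ {x} → 0 < x → ℕ→ℚ x ≢ 0ℚ
ℕ→ℚ≢0 {suc x} _ x≡0 = contradiction (ℕ→ℚ-cancel-≤ {suc x} {0} (ℚP.≤-reflexive x≡0)) λ ()

module _ {q : ℚ} (q≢0 : q ≢ 0ℚ) where

  private
    q⁻¹ = ℚ.1/_ q {{ℚ.≢-nonZero q≢0}}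

  ÷-spec : ∀ p → p ÷ q ≡ p ℚ.* q⁻¹
  ÷-spec p with q ℚP.≟ 0ℚ
  ... | yes q≡0 = contradiction q≡0 q≢0
  ... | no _    = refl

  ÷-*-cancel : ∀ p → (p ÷ q) ℚ.* q ≡ p
  ÷-*-cancel p = begin
    (p ÷ q) ℚ.* q              ≡⟨ cong (ℚ._* q) (÷-spec p) ⟩
    p ℚ.* q⁻¹ ℚ.* q            ≡⟨ ℚP.*-assoc p q⁻¹ q ⟩
    p ℚ.* (q⁻¹ ℚ.* q)          ≡⟨ cong (p ℚ.*_) (ℚP.*-inverseˡ q {{ℚ.≢-nonZero q≢0}}) ⟩
    p ℚ.* 1ℚ                   ≡⟨ ℚP.*-identityʳ p ⟩
    p                          ∎
    where open ≡-Reasoning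

  ℚ-*-cancelʳ : ∀ {x y} → x ℚ.* q ≡ y ℚ.* q → x ≡ y
  ℚ-*-cancelʳ {x} {y} xq≡yq = begin
    x                          ≡⟨ ℚP.*-identityʳ x ⟨
    x ℚ.* 1ℚ                   ≡⟨ cong (x ℚ.*_) (ℚP.*-inverseʳ q {{ℚ.≢-nonZero q≢0}}) ⟨
    x ℚ.* (q ℚ.* q⁻¹)          ≡⟨ ℚP.*-assoc x q q⁻¹ ⟨
    x ℚ.* q ℚ.* q⁻¹            ≡⟨ cong (ℚ._* q⁻¹) xq≡yq ⟩
    y ℚ.* q ℚ.* q⁻¹            ≡⟨ ℚP.*-assoc y q q⁻¹ ⟩
    y ℚ.* (q ℚ.* q⁻¹)          ≡⟨ cong (y ℚ.*_) (ℚP.*-inverseʳ q {{ℚ.≢-nonZero q≢0}}) ⟩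
    y ℚ.* 1ℚ                   ≡⟨ ℚP.*-identityʳ y ⟩
    y                          ∎
    where open ≡-Reasoning

  ÷-unique : ∀ {p x} → x ℚ.* q ≡ p → p ÷ q ≡ x
  ÷-unique {p} xq≡p = ℚ-*-cancelʳ (trans (÷-*-cancel p) (sym xq≡p))

÷-≢0 : ∀ {u w} → u ≢ 0ℚ → w ≢ 0ℚ → u ÷ w ≢ 0ℚ
÷-≢0 {u} {w} u≢0 w≢0 u÷w≡0 = u≢0 (trans (sym (÷-*-cancel w≢0 u)) (trans (cong (ℚ._* w) u÷w≡0) (ℚP.*-zeroˡ w)))

1÷[u÷w] : ∀ {u w} → u ≢ 0ℚ → w ≢ 0ℚ → 1ℚ ÷ (u ÷ w) ≡ w ÷ u
1÷[u÷w] {u} {w} u≢0 w≢0 = ÷-unique (÷-≢0 u≢0 w≢0) (ℚ-*-cancelʳ w≢0 (begin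
  (w ÷ u) ℚ.* (u ÷ w) ℚ.* w      ≡⟨ ℚP.*-assoc (w ÷ u) (u ÷ w) w ⟩
  (w ÷ u) ℚ.* ((u ÷ w) ℚ.* w)    ≡⟨ cong ((w ÷ u) ℚ.*_) (÷-*-cancel w≢0 u) ⟩
  (w ÷ u) ℚ.* u                  ≡⟨ ÷-*-cancel u≢0 w ⟩
  w                              ≡⟨ ℚP.*-identityˡ w ⟨
  1ℚ ℚ.* w                       ∎))
  where open ≡-Reasoning

_/ℕ_ : ℕ → ℕ → ℚ
x /ℕ y = ℕ→ℚ x ÷ ℕ→ℚ y

/ℕ-*-cancel : ∀ x {y} → 0 < y → (x /ℕ y) ℚ.* ℕ→ℚ y ≡ ℕ→ℚ x
/ℕ-*-cancel x y>0 = ÷-*-cancel (ℕ→ℚ≢0 y>0) (ℕ→ℚ x)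

/ℕ-mono-≤ : ∀ {x y u w} → 0 < y → 0 < w → x * w ≤ u * y → x /ℕ y ℚ.≤ u /ℕ w
/ℕ-mono-≤ {x} {y} {u} {w} y>0 w>0 xw≤uy = ℚP.*-cancelʳ-≤-pos (ℕ→ℚ (y * w)) {{ℕ→ℚ-positive (*-mono-< y>0 w>0)}}
  (subst₂ ℚ._≤_ (sym (scaled x y w y>0)) (sym (trans (cong (u /ℕ w ℚ.*_) (cong ℕ→ℚ (*-comm y w))) (scaled u w y w>0))) (ℕ→ℚ-mono-≤ xw≤uy))
  where
  scaled : ∀ a b c → 0 < b → (a /ℕ b) ℚ.* ℕ→ℚ (b * c) ≡ ℕ→ℚ (a * c)
  scaled a b c b>0 = begin
    (a /ℕ b) ℚ.* ℕ→ℚ (b * c)          ≡⟨ cong ((a /ℕ b) ℚ.*_) (ℕ→ℚ-homo-* b c) ⟩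
    (a /ℕ b) ℚ.* (ℕ→ℚ b ℚ.* ℕ→ℚ c)      ≡⟨ ℚP.*-assoc (a /ℕ b) _ _ ⟨
    (a /ℕ b) ℚ.* ℕ→ℚ b ℚ.* ℕ→ℚ c        ≡⟨ cong (ℚ._* ℕ→ℚ c) (/ℕ-*-cancel a b>0) ⟩
    ℕ→ℚ a ℚ.* ℕ→ℚ c                     ≡⟨ ℕ→ℚ-homo-* a c ⟨
    ℕ→ℚ (a * c)                       ∎
    where open ≡-Reasoning

/ℕ-+ : ∀ a {b} c {d} → 0 < b → 0 < d → a /ℕ b ℚ.+ c /ℕ d ≡ (a * d + c * b) /ℕ (b * d)
/ℕ-+ a {b} c {d} b>0 d>0 = sym (÷-unique (ℕ→ℚ≢0 (*-mono-< b>0 d>0)) (begin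
  (a /ℕ b ℚ.+ c /ℕ d) ℚ.* ℕ→ℚ (b * d)
    ≡⟨ cong ((a /ℕ b ℚ.+ c /ℕ d) ℚ.*_) (ℕ→ℚ-homo-* b d) ⟩
  (a /ℕ b ℚ.+ c /ℕ d) ℚ.* (ℕ→ℚ b ℚ.* ℕ→ℚ d)
    ≡⟨ solveℚ 4 (λ X Y B D → (X ⊕ Y) ⊛ (B ⊛ D) ⊜ (X ⊛ B) ⊛ D ⊕ (Y ⊛ D) ⊛ B) refl (a /ℕ b) (c /ℕ d) (ℕ→ℚ b) (ℕ→ℚ d) ⟩
  (a /ℕ b ℚ.* ℕ→ℚ b) ℚ.* ℕ→ℚ d ℚ.+ (c /ℕ d ℚ.* ℕ→ℚ d) ℚ.* ℕ→ℚ b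
    ≡⟨ cong₂ (λ s t → s ℚ.* ℕ→ℚ d ℚ.+ t ℚ.* ℕ→ℚ b) (/ℕ-*-cancel a b>0) (/ℕ-*-cancel c d>0) ⟩
  ℕ→ℚ a ℚ.* ℕ→ℚ d ℚ.+ ℕ→ℚ c ℚ.* ℕ→ℚ b
    ≡⟨ cong₂ ℚ._+_ (ℕ→ℚ-homo-* a d) (ℕ→ℚ-homo-* c b) ⟨
  ℕ→ℚ (a * d) ℚ.+ ℕ→ℚ (c * b)
    ≡⟨ ℕ→ℚ-homo-+ (a * d) (c * b) ⟨
  ℕ→ℚ (a * d + c * b)                                   ∎))
  where
  open ≡-Reasoning

/ℕ-cancelˡ : ∀ m x {y} → 0 < m → 0 < y → (m * x) /ℕ (m * y) ≡ x /ℕ y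
/ℕ-cancelˡ m x {y} m>0 y>0 = ÷-unique (ℕ→ℚ≢0 (*-mono-< m>0 y>0)) (begin
  x /ℕ y ℚ.* ℕ→ℚ (m * y)             ≡⟨ cong (x /ℕ y ℚ.*_) (trans (cong ℕ→ℚ (*-comm m y)) (ℕ→ℚ-homo-* y m)) ⟩
  x /ℕ y ℚ.* (ℕ→ℚ y ℚ.* ℕ→ℚ m)         ≡⟨ ℚP.*-assoc (x /ℕ y) _ _ ⟨
  x /ℕ y ℚ.* ℕ→ℚ y ℚ.* ℕ→ℚ m           ≡⟨ cong (ℚ._* ℕ→ℚ m) (/ℕ-*-cancel x y>0) ⟩
  ℕ→ℚ x ℚ.* ℕ→ℚ m                      ≡⟨ trans (cong ℕ→ℚ (*-comm m x)) (ℕ→ℚ-homo-* x m) ⟨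
  ℕ→ℚ (m * x)                        ∎)
  where open ≡-Reasoning

a≤c+b⇒a-b≤c : ∀ a b c → a ℚ.≤ c ℚ.+ b → a ℚ.- b ℚ.≤ c
a≤c+b⇒a-b≤c a b c a≤c+b = ℚP.≤-trans (ℚP.+-monoˡ-≤ (ℚ.- b) a≤c+b)
  (ℚP.≤-reflexive (solveℚ 2 (λ c b → (c ⊕ b) ⊖ b ⊜ c) refl c b))

positive-as-/ℕ : ∀ ε → 0ℚ ℚ.< ε → Σ ℕ λ p → Σ ℕ λ q → 0 < p × 0 < q × ε ≡ p /ℕ q
positive-as-/ℕ ε@(mkℚ (ℤ.+ suc p) d _) _ = suc p , suc d , s≤s z≤n , s≤s z≤n ,
  sym (÷-unique (ℕ→ℚ≢0 {suc d} (s≤s z≤n)) (ℚP.toℚᵘ-injective (begin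
    toℚᵘ (ε ℚ.* ℕ→ℚ (suc d))                  ≈⟨ ℚP.toℚᵘ-homo-* ε (ℕ→ℚ (suc d)) ⟩
    toℚᵘ ε ℚᵘ.* toℚᵘ (ℕ→ℚ (suc d))            ≈⟨ ℚᵘP.*-congˡ {toℚᵘ ε} (toℚᵘ-ℤ→ℚ (ℤ.+ suc d)) ⟩
    mkℚᵘ (ℤ.+ suc p) d ℚᵘ.* mkℚᵘ (ℤ.+ suc d) 0    ≈⟨ *≡* (ℤP.*-assoc (ℤ.+ suc p) (ℤ.+ suc d) (ℤ.+ 1)) ⟩
    mkℚᵘ (ℤ.+ suc p) 0                          ≈⟨ toℚᵘ-ℤ→ℚ (ℤ.+ suc p) ⟨
    toℚᵘ (ℕ→ℚ (suc p))                        ∎)))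
  where open ≃-Reasoning
positive-as-/ℕ (mkℚ (ℤ.+ zero) d _) (ℚ.*<* 0<0) = contradiction (subst₂ ℤ._<_ (ℤP.*-zeroˡ (ℤ.+ suc d)) (ℤP.*-zeroˡ (ℤ.+ 1)) 0<0) (ℤP.<-irrefl refl)
positive-as-/ℕ (mkℚ ℤ.-[1+ n ] d _) (ℚ.*<* 0<ε) = contradiction (subst₂ ℤ._<_ (ℤP.*-zeroˡ (ℤ.+ suc d)) (ℤP.*-identityʳ ℤ.-[1+ n ]) 0<ε)
    (ℤP.<-asym (ℤ.-<+ {n = 0}))

/ℕ-*-≡ : ∀ {x y m n} → 0 < y → x * m ≡ n * y → (x /ℕ y) ℚ.* ℕ→ℚ m ≡ ℕ→ℚ n
/ℕ-*-≡ {x} {y} {m} {n} y>0 xm≡ny = ℚ-*-cancelʳ (ℕ→ℚ≢0 y>0) (begin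
  (x /ℕ y) ℚ.* ℕ→ℚ m ℚ.* ℕ→ℚ y        ≡⟨ solveℚ 3 (λ X m y → X ⊛ m ⊛ y ⊜ X ⊛ y ⊛ m) refl (x /ℕ y) (ℕ→ℚ m) (ℕ→ℚ y) ⟩
  (x /ℕ y) ℚ.* ℕ→ℚ y ℚ.* ℕ→ℚ m        ≡⟨ cong (ℚ._* ℕ→ℚ m) (/ℕ-*-cancel x y>0) ⟩
  ℕ→ℚ x ℚ.* ℕ→ℚ m                     ≡⟨ trans (sym (ℕ→ℚ-homo-* x m)) (trans (cong ℕ→ℚ xm≡ny) (ℕ→ℚ-homo-* n y)) ⟩
  ℕ→ℚ n ℚ.* ℕ→ℚ y                     ∎)
  where open ≡-Reasoning

cross-above : ∀ {x B N E M p q} → 0 < M → M * x * E ≤ suc M * N * B → N * q ≤ M * p * E →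
  x * (E * q) ≤ (N * q + p * E) * B
cross-above {x} {B} {N} {E} {M} {p} {q} M>0 close small = *-cancelˡ-≤ M {{>-nonZero M>0}} (begin
  M * (x * (E * q))
    ≡⟨ solve 4 (λ M x E q → M :* (x :* (E :* q)) := M :* x :* E :* q) refl M x E q ⟩
  M * x * E * q
    ≤⟨ *-monoˡ-≤ q close ⟩
  suc M * N * B * q
    ≡⟨ solve 4 (λ M N B q → (con 1 :+ M) :* N :* B :* q := M :* (N :* q :* B) :+ N :* q :* B) refl M N B q ⟩
  M * (N * q * B) + N * q * B
    ≤⟨ +-monoʳ-≤ (M * (N * q * B)) (*-monoˡ-≤ B small) ⟩
  M * (N * q * B) + M * p * E * B
    ≡⟨ solve 6 (λ M N q B p E → M :* (N :* q :* B) :+ M :* p :* E :* B := M :* ((N :* q :+ p :* E) :* B)) refl M N q B p E ⟩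
  M * ((N * q + p * E) * B)                ∎)
  where open ≤-Reasoning

cross-below : ∀ {x B N E M p q} → M * N * B ≤ suc M * x * E → N * q ≤ M * p * E →
  N * (B * q) ≤ (x * q + p * B) * E
cross-below {x} {B} {N} {E} {M} {p} {q} close small = *-cancelˡ-≤ (suc M) (begin
  suc M * (N * (B * q))
    ≡⟨ solve 4 (λ M N B q → (con 1 :+ M) :* (N :* (B :* q)) := M :* N :* B :* q :+ N :* q :* B) refl M N B q ⟩
  M * N * B * q + N * q * B
    ≤⟨ +-mono-≤ (*-monoˡ-≤ q close) (*-monoˡ-≤ B (≤-trans small (*-monoˡ-≤ E (*-monoˡ-≤ p (n≤1+n M))))) ⟩
  suc M * x * E * q + suc M * p * E * B
    ≡⟨ solve 6 (λ M x E q p B → M :* x :* E :* q :+ M :* p :* E :* B := M :* ((x :* q :+ p :* B) :* E)) refl (suc M) x E q p B ⟩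
  suc M * ((x * q + p * B) * E)            ∎)
  where open ≤-Reasoning

within-above : ∀ {x B N E M p q} → 0 < B → 0 < E → 0 < q → 0 < M →
  M * x * E ≤ suc M * N * B → N * q ≤ M * p * E → x /ℕ B ℚ.≤ N /ℕ E ℚ.+ p /ℕ q
within-above {x} {B} {N} {E} {M} {p} {q} B>0 E>0 q>0 M>0 close small = begin
  x /ℕ B
    ≤⟨ /ℕ-mono-≤ {x} {B} {N * q + p * E} B>0 (*-mono-< E>0 q>0) (cross-above {x} {B} {N} {E} {M} {p} {q} M>0 close small) ⟩
  (N * q + p * E) /ℕ (E * q)
    ≡⟨ /ℕ-+ N p E>0 q>0 ⟨
  N /ℕ E ℚ.+ p /ℕ q                        ∎
  where open ℚP.≤-Reasoning

within-below : ∀ {x B N E M p q} → 0 < B → 0 < E → 0 < q →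
  M * N * B ≤ suc M * x * E → N * q ≤ M * p * E → N /ℕ E ℚ.- p /ℕ q ℚ.≤ x /ℕ B
within-below {x} {B} {N} {E} {M} {p} {q} B>0 E>0 q>0 close small = a≤c+b⇒a-b≤c (N /ℕ E) (p /ℕ q) (x /ℕ B) (begin
  N /ℕ E
    ≤⟨ /ℕ-mono-≤ {N} {E} {x * q + p * B} E>0 (*-mono-< B>0 q>0) (cross-below {x} {B} {N} {E} {M} {p} {q} close small) ⟩
  (x * q + p * B) /ℕ (B * q)
    ≡⟨ /ℕ-+ x p B>0 q>0 ⟨
  x /ℕ B ℚ.+ p /ℕ q                        ∎)
  where open ℚP.≤-Reasoning

+[m+1]-1 : ∀ m → ℤ.+ (m + 1) ℤ.+ ℤ.-1ℤ ≡ ℤ.+ m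
+[m+1]-1 m = trans (ℤP.m-n≡m⊖n (m + 1) 1) (trans (ℤP.⊖-≥ (m≤n+m 1 m)) (cong ℤ.+_ (m+n∸n≡m m 1)))

pos-^ : ∀ b e → (ℤ.+ b) ℤ.^ e ≡ ℤ.+ (b ^ e)
pos-^ b zero    = refl
pos-^ b (suc e) = trans (cong ((ℤ.+ b) ℤ.*_) (pos-^ b e)) (sym (ℤP.pos-* b (b ^ e)))

prodℤ≡+∏ : ∀ {r} (f : Fin r → ℤ) (g : Fin r → ℕ) → (∀ i → f i ≡ ℤ.+ g i) → prodℤ f ≡ ℤ.+ ∏ g
prodℤ≡+∏ f g f≗g = trans (foldr-allFin ℤ._*_ ℤ.1ℤ f) (go f g f≗g)
  where
  go : ∀ {r} (f : Fin r → ℤ) (g : Fin r → ℕ) → (∀ i → f i ≡ ℤ.+ g i) → VF.foldr ℤ._*_ ℤ.1ℤ f ≡ ℤ.+ ∏ g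
  go {zero}  f g f≗g = refl
  go {suc r} f g f≗g = trans (cong₂ ℤ._*_ (f≗g zero) (go (f ∘ suc) (g ∘ suc) (f≗g ∘ suc))) (sym (ℤP.pos-* (g zero) (∏ (g ∘ suc))))

sumℚ-*ʳ : ∀ {r} (f : Fin r → ℚ) c → sumℚ f ℚ.* c ≡ sumℚ (λ i → f i ℚ.* c)
sumℚ-*ʳ f c = trans (cong (ℚ._* c) (foldr-allFin ℚ._+_ 0ℚ f)) (trans (go f) (sym (foldr-allFin ℚ._+_ 0ℚ (λ i → f i ℚ.* c))))
  where
  go : ∀ {r} (f : Fin r → ℚ) → VF.foldr ℚ._+_ 0ℚ f ℚ.* c ≡ VF.foldr ℚ._+_ 0ℚ (λ i → f i ℚ.* c)
  go {zero}  f = ℚP.*-zeroˡ c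
  go {suc r} f = trans (ℚP.*-distribʳ-+ c (f zero) _) (cong (f zero ℚ.* c ℚ.+_) (go (f ∘ suc)))

sumℚ-ℕ→ℚ : ∀ {r} (g : Fin r → ℕ) → sumℚ (λ i → ℕ→ℚ (g i)) ≡ ℕ→ℚ (∑ g)
sumℚ-ℕ→ℚ g = trans (foldr-allFin ℚ._+_ 0ℚ (λ i → ℕ→ℚ (g i))) (go g)
  where
  go : ∀ {r} (g : Fin r → ℕ) → VF.foldr ℚ._+_ 0ℚ (λ i → ℕ→ℚ (g i)) ≡ ℕ→ℚ (∑ g)
  go {zero}  g = refl
  go {suc r} g = trans (cong (ℕ→ℚ (g zero) ℚ.+_) (go (g ∘ suc))) (sym (ℕ→ℚ-homo-+ (g zero) (∑ (g ∘ suc))))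

sumℚ-cong : ∀ {r} {f g : Fin r → ℚ} → (∀ i → f i ≡ g i) → sumℚ f ≡ sumℚ g
sumℚ-cong {r} f≗g = cong (List.foldr ℚ._+_ 0ℚ) (map-cong f≗g (List.allFin r))


-- LimitOfMaxIs k r j σ is LimitOfMax k r (InFamily k r j σ) by definition.
LimitOfMax : (k r : ℕ) → ((n : ℕ) → ColHG k r (k * r * n) → Set) → ℚ → Set
LimitOfMax k r F L = ∀ ε → 0ℚ ℚ.< ε → Σ ℕ λ N₀ → ∀ n → N₀ ≤ n →
  (∀ H → F n H → normDeg H ℚ.≤ L ℚ.+ ε) × Σ (ColHG k r (k * r * n)) (λ H → F n H × L ℚ.- ε ℚ.≤ normDeg H)

LimitOfMax-⇔ : ∀ {k r F G L} → (∀ n H → F n H → G n H) → (∀ n H → G n H → F n H) → LimitOfMax k r F L → LimitOfMax k r G L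
LimitOfMax-⇔ F⇒G G⇒F lim ε ε>0 =
  let N₀ , bounds = lim ε ε>0 in
  N₀ , λ n N₀≤n → let upper , H , F-H , lower = bounds n N₀≤n in
                  (λ H′ G-H′ → upper H′ (G⇒F n H′ G-H′)) , H , F⇒G n H F-H , lower

module TypedFamily (k r : ℕ) (a : Fin r → ℕ) (T : Fin r → Fin r → ℕ)
               (∑T≡k : ∀ c → ∑ (T c) ≡ k) (a>0 : ∀ i → 0 < a i) where

  ∏a^T ∏T! : Fin r → ℕ
  ∏a^T c = ∏ (λ s → a s ^ T c s)
  ∏T!  c = ∏ (λ s → T c s !)

  private
    ∏T!∣k! : ∀ c → ∏T! c ∣ k !
    ∏T!∣k! c = subst (λ m → ∏T! c ∣ m !) (∑T≡k c) (∏!∣∑! (T c))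

  multinomialOf : Fin r → ℕ
  multinomialOf c = _∣_.quotient (∏T!∣k! c)

  multinomialOf-spec : ∀ c → multinomialOf c * ∏T! c ≡ k !
  multinomialOf-spec c = sym (_∣_.equality (∏T!∣k! c))

  -- Up to the factor n^k / k!, weight c counts the k-sets of type T c.
  weight : Fin r → ℕ
  weight c = ∏a^T c * multinomialOf c

  S : Fin r → ℕ
  S l = ∑ (λ c → T c l * weight c)

  -- The normalised degree of a vertex of part l tends to degNum l / degDen l.
  degNum degDen : Fin r → ℕ
  degNum l = r * S l
  degDen l = a l * (k * r) ^ k

  binom : ℕ → ℕ
  binom n = (k * r * n ∸ 1) C (k ∸ 1)

  EdgesTyped : ∀ {N} → ColHG k r N → (Fin N → Fin r) → Set
  EdgesTyped H p = ∀ e c → col H e ≡ just c → ∀ i → typeOf p e i ≡ T c i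

  Family : (n : ℕ) → ColHG k r (k * r * n) → Set
  Family n H = Σ (Fin (k * r * n) → Fin r) λ p → (∀ i → partSize p i ≡ a i * n) × EdgesTyped H p

  #edges∋ : ∀ {N} → (Fin N → Fin r) → Fin N → ℕ
  #edges∋ p v = ∑ (λ c → #ofType∋ p v (T c))

  module Counting (n : ℕ) (p : Fin (k * r * n) → Fin r) (sizes : ∀ i → partSize p i ≡ a i * n) where

    #edges : Fin r → ℕ
    #edges c = #ofType p (T c)

    #edges-*-∏T! : ∀ c → #edges c * ∏T! c ≡ ∏ (λ s → (a s * n) P′ T c s)
    #edges-*-∏T! c = begin
      #ofType p (T c) * ∏T! c
        ≡⟨ cong (_* ∏T! c) (#ofType-closed p (T c)) ⟩
      ∏ (λ s → partSize p s C T c s) * ∏T! c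
        ≡⟨ ∏-distrib-* (λ s → partSize p s C T c s) (λ s → T c s !) ⟨
      ∏ (λ s → (partSize p s C T c s) * T c s !)
        ≡⟨ ∏-cong (λ s → trans (C*!≡P′ (partSize p s) (T c s)) (cong (_P′ T c s) (sizes s))) ⟩
      ∏ (λ s → (a s * n) P′ T c s)                            ∎
      where open ≡-Reasoning

    ∏P′≤∏a^T*n^k : ∀ c → ∏ (λ s → (a s * n) P′ T c s) ≤ ∏a^T c * n ^ k
    ∏P′≤∏a^T*n^k c = begin
      ∏ (λ s → (a s * n) P′ T c s)
        ≤⟨ ∏-mono-≤ (λ s → P′≤^ (a s * n) (T c s)) ⟩
      ∏ (λ s → (a s * n) ^ T c s)
        ≡⟨ ∏-cong (λ s → ^-distribʳ-* (a s) n (T c s)) ⟩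
      ∏ (λ s → a s ^ T c s * n ^ T c s)
        ≡⟨ ∏-distrib-* (λ s → a s ^ T c s) (λ s → n ^ T c s) ⟩
      ∏a^T c * ∏ (λ s → n ^ T c s)
        ≡⟨ cong (∏a^T c *_) (trans (∏-^ n (T c)) (cong (n ^_) (∑T≡k c))) ⟩
      ∏a^T c * n ^ k                                          ∎
      where open ≤-Reasoning

    ∏a^T*P′≤∏P′ : ∀ c → ∏a^T c * (n P′ k) ≤ ∏ (λ s → (a s * n) P′ T c s)
    ∏a^T*P′≤∏P′ c = begin
      ∏a^T c * (n P′ k)                                       ≡⟨ cong (λ m → ∏a^T c * (n P′ m)) (∑T≡k c) ⟨
      ∏a^T c * (n P′ ∑ (T c))                                 ≤⟨ *-monoʳ-≤ (∏a^T c) (P′-∑ n (T c)) ⟩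
      ∏a^T c * ∏ (λ s → n P′ T c s)                           ≡⟨ ∏-distrib-* (λ s → a s ^ T c s) (λ s → n P′ T c s) ⟨
      ∏ (λ s → a s ^ T c s * (n P′ T c s))                    ≤⟨ ∏-mono-≤ (λ s → ^*P′≤P′ (a s) n (T c s) (a>0 s)) ⟩
      ∏ (λ s → (a s * n) P′ T c s)                            ∎
      where open ≤-Reasoning

    #edges-upper : ∀ c → #edges c * k ! ≤ weight c * n ^ k
    #edges-upper c = begin
      #edges c * k !
        ≡⟨ cong (#edges c *_) (multinomialOf-spec c) ⟨
      #edges c * (multinomialOf c * ∏T! c)
        ≡⟨ x∙yz≈y∙xz (#edges c) (multinomialOf c) (∏T! c) ⟩
      multinomialOf c * (#edges c * ∏T! c)
        ≡⟨ cong (multinomialOf c *_) (#edges-*-∏T! c) ⟩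
      multinomialOf c * ∏ (λ s → (a s * n) P′ T c s)
        ≤⟨ *-monoʳ-≤ (multinomialOf c) (∏P′≤∏a^T*n^k c) ⟩
      multinomialOf c * (∏a^T c * n ^ k)
        ≡⟨ solve 3 (λ m q x → m :* (q :* x) := q :* m :* x) refl (multinomialOf c) (∏a^T c) (n ^ k) ⟩
      weight c * n ^ k                                        ∎
      where open ≤-Reasoning

    #edges-lower : ∀ c → weight c * (n P′ k) ≤ #edges c * k !
    #edges-lower c = begin
      weight c * (n P′ k)
        ≡⟨ solve 3 (λ m q x → q :* m :* x := m :* (q :* x)) refl (multinomialOf c) (∏a^T c) (n P′ k) ⟩
      multinomialOf c * (∏a^T c * (n P′ k))
        ≤⟨ *-monoʳ-≤ (multinomialOf c) (∏a^T*P′≤∏P′ c) ⟩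
      multinomialOf c * ∏ (λ s → (a s * n) P′ T c s)
        ≡⟨ cong (multinomialOf c *_) (#edges-*-∏T! c) ⟨
      multinomialOf c * (#edges c * ∏T! c)
        ≡⟨ x∙yz≈y∙xz (multinomialOf c) (#edges c) (∏T! c) ⟩
      #edges c * (multinomialOf c * ∏T! c)
        ≡⟨ cong (#edges c *_) (multinomialOf-spec c) ⟩
      #edges c * k !                                          ∎
      where open ≤-Reasoning

    #edges∋-* : ∀ v → #edges∋ p v * (a (p v) * n) ≡ ∑ (λ c → #edges c * T c (p v))
    #edges∋-* v = begin
      #edges∋ p v * (a (p v) * n)
        ≡⟨ ∑-*ʳ (a (p v) * n) (λ c → #ofType∋ p v (T c)) ⟨
      ∑ (λ c → #ofType∋ p v (T c) * (a (p v) * n))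
        ≡⟨ ∑-cong (λ c → trans (cong (#ofType∋ p v (T c) *_) (sym (sizes (p v)))) (#ofType∋-* p v (T c))) ⟩
      ∑ (λ c → #edges c * T c (p v))                          ∎
      where open ≡-Reasoning

    ∑#edges-upper : ∀ l → ∑ (λ c → #edges c * T c l) * k ! ≤ S l * n ^ k
    ∑#edges-upper l = begin
      ∑ (λ c → #edges c * T c l) * k !
        ≡⟨ ∑-*ʳ (k !) (λ c → #edges c * T c l) ⟨
      ∑ (λ c → #edges c * T c l * k !)                        ≤⟨ ∑-mono-≤ (λ c → ≤-trans (≤-reflexive (*-right-comm (#edges c) (T c l) (k !)))
                                                                                    (*-monoˡ-≤ (T c l) (#edges-upper c))) ⟩
      ∑ (λ c → weight c * n ^ k * T c l)
        ≡⟨ ∑-cong (λ c → *-right-comm (weight c) (n ^ k) (T c l)) ⟩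
      ∑ (λ c → weight c * T c l * n ^ k)
        ≡⟨ ∑-*ʳ (n ^ k) (λ c → weight c * T c l) ⟩
      ∑ (λ c → weight c * T c l) * n ^ k
        ≡⟨ cong (_* n ^ k) (∑-cong (λ c → *-comm (weight c) (T c l))) ⟩
      S l * n ^ k                                             ∎
      where open ≤-Reasoning

    ∑#edges-lower : ∀ l → S l * (n P′ k) ≤ ∑ (λ c → #edges c * T c l) * k !
    ∑#edges-lower l = begin
      S l * (n P′ k)
        ≡⟨ ∑-*ʳ (n P′ k) (λ c → T c l * weight c) ⟨
      ∑ (λ c → T c l * weight c * (n P′ k))                   ≤⟨ ∑-mono-≤ (λ c → ≤-trans (≤-reflexive (*-assoc (T c l) (weight c) (n P′ k)))
                                                                                    (*-monoʳ-≤ (T c l) (#edges-lower c))) ⟩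
      ∑ (λ c → T c l * (#edges c * k !))
        ≡⟨ ∑-cong (λ c → solve 3 (λ t e f → t :* (e :* f) := e :* t :* f) refl (T c l) (#edges c) (k !)) ⟩
      ∑ (λ c → #edges c * T c l * k !)
        ≡⟨ ∑-*ʳ (k !) (λ c → #edges c * T c l) ⟩
      ∑ (λ c → #edges c * T c l) * k !                        ∎
      where open ≤-Reasoning

    module _ (k>0 : 0 < k) (r>0 : 0 < r) (n>0 : 0 < n) where

      private
        cancel : ∀ {x y} l → x * (a l * n * k !) ≤ y * (a l * n * k !) → x ≤ y
        cancel {x} {y} l = *-cancelʳ-≤ x y _ {{>-nonZero (*-mono-< (*-mono-< (a>0 l) n>0) (1≤n! k))}}
        kr>0 = *-mono-< k>0 r>0

      upper-core : ∀ v → #edges∋ p v * degDen (p v) * (n P′ k) ≤ degNum (p v) * n ^ k * binom n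
      upper-core v = cancel l (begin
        #edges∋ p v * degDen l * (n P′ k) * (a l * n * k !)
          ≡⟨ solve 6 (λ d al n f K φ → d :* (al :* K) :* φ :* (al :* n :* f) := d :* (al :* n) :* f :* (al :* K :* φ))
               refl (#edges∋ p v) (a l) n (k !) ((k * r) ^ k) (n P′ k) ⟩
        #edges∋ p v * (a l * n) * k ! * (a l * (k * r) ^ k * (n P′ k))
          ≡⟨ cong (λ x → x * k ! * (a l * (k * r) ^ k * (n P′ k))) (#edges∋-* v) ⟩
        ∑ (λ c → #edges c * T c l) * k ! * (a l * (k * r) ^ k * (n P′ k))
          ≤⟨ *-monoˡ-≤ (a l * (k * r) ^ k * (n P′ k)) (∑#edges-upper l) ⟩
        S l * n ^ k * (a l * (k * r) ^ k * (n P′ k))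
          ≤⟨ *-monoʳ-≤ (S l * n ^ k) (≤-trans (≤-reflexive (*-assoc (a l) _ _)) (*-monoʳ-≤ (a l) (^*P′≤P′ (k * r) n k kr>0))) ⟩
        S l * n ^ k * (a l * ((k * r * n) P′ k))
          ≡⟨ cong (λ x → S l * n ^ k * (a l * x)) ([krn∸1]C[k∸1]*n*r*k!≡krnP′k k r n k>0) ⟨
        S l * n ^ k * (a l * (binom n * n * r * k !))
          ≡⟨ solve 7 (λ S P al B n r f → S :* P :* (al :* (B :* n :* r :* f)) := r :* S :* P :* B :* (al :* n :* f))
               refl (S l) (n ^ k) (a l) (binom n) n r (k !) ⟩
        degNum l * n ^ k * binom n * (a l * n * k !) ∎)
        where
        open ≤-Reasoning
        l = p v

      lower-core : ∀ v → degNum (p v) * (n P′ k) * binom n ≤ #edges∋ p v * degDen (p v) * n ^ k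
      lower-core v = cancel l (begin
        degNum l * (n P′ k) * binom n * (a l * n * k !)
          ≡⟨ solve 7 (λ S φ al B n r f → r :* S :* φ :* B :* (al :* n :* f) := S :* φ :* (al :* (B :* n :* r :* f)))
               refl (S l) (n P′ k) (a l) (binom n) n r (k !) ⟩
        S l * (n P′ k) * (a l * (binom n * n * r * k !))
          ≡⟨ cong (λ x → S l * (n P′ k) * (a l * x)) ([krn∸1]C[k∸1]*n*r*k!≡krnP′k k r n k>0) ⟩
        S l * (n P′ k) * (a l * ((k * r * n) P′ k))
          ≤⟨ *-monoʳ-≤ (S l * (n P′ k)) (*-monoʳ-≤ (a l) (≤-trans (P′≤^ (k * r * n) k) (≤-reflexive (^-distribʳ-* (k * r) n k)))) ⟩
        S l * (n P′ k) * (a l * ((k * r) ^ k * n ^ k))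
          ≤⟨ ≤-trans (≤-reflexive (cong (S l * (n P′ k) *_) (sym (*-assoc (a l) ((k * r) ^ k) (n ^ k)))))
               (*-monoˡ-≤ (a l * (k * r) ^ k * n ^ k) (∑#edges-lower l)) ⟩
        ∑ (λ c → #edges c * T c l) * k ! * (a l * (k * r) ^ k * n ^ k)
          ≡⟨ cong (λ x → x * k ! * (a l * (k * r) ^ k * n ^ k)) (#edges∋-* v) ⟨
        #edges∋ p v * (a l * n) * k ! * (a l * (k * r) ^ k * n ^ k)
          ≡⟨ solve 6 (λ d al n f K P → d :* (al :* n) :* f :* (al :* K :* P) := d :* (al :* K) :* P :* (al :* n :* f))
               refl (#edges∋ p v) (a l) n (k !) ((k * r) ^ k) (n ^ k) ⟩
        #edges∋ p v * degDen l * n ^ k * (a l * n * k !) ∎)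
        where
        open ≤-Reasoning
        l = p v

      module _ (M : ℕ) (n-large : suc M * (k * k) ≤ n) where

        private
          cancel-n^k : ∀ {x y} → x * n ^ k ≤ y * n ^ k → x ≤ y
          cancel-n^k {x} {y} = *-cancelʳ-≤ x y (n ^ k) {{m^n≢0 n k {{>-nonZero n>0}}}}
          power≤ = power≤falling M n k n>0 n-large

        upper-approx : ∀ v → M * #edges∋ p v * degDen (p v) ≤ suc M * degNum (p v) * binom n
        upper-approx v = cancel-n^k (begin
          M * x * E * n ^ k
            ≡⟨ solve 4 (λ M x E P → M :* x :* E :* P := x :* E :* (M :* P)) refl M x E (n ^ k) ⟩
          x * E * (M * n ^ k)
            ≤⟨ *-monoʳ-≤ (x * E) power≤ ⟩
          x * E * (suc M * (n P′ k))
            ≡⟨ solve 4 (λ x E M φ → x :* E :* (M :* φ) := M :* (x :* E :* φ)) refl x E (suc M) (n P′ k) ⟩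
          suc M * (x * E * (n P′ k))
            ≤⟨ *-monoʳ-≤ (suc M) (upper-core v) ⟩
          suc M * (N * n ^ k * B)
            ≡⟨ solve 4 (λ M N P B → M :* (N :* P :* B) := M :* N :* B :* P) refl (suc M) N (n ^ k) B ⟩
          suc M * N * B * n ^ k        ∎)
          where
          open ≤-Reasoning
          x = #edges∋ p v
          E = degDen (p v)
          N = degNum (p v)
          B = binom n

        lower-approx : ∀ v → M * degNum (p v) * binom n ≤ suc M * #edges∋ p v * degDen (p v)
        lower-approx v = cancel-n^k (begin
          M * N * B * n ^ k
            ≡⟨ solve 4 (λ M N B P → M :* N :* B :* P := N :* B :* (M :* P)) refl M N B (n ^ k) ⟩
          N * B * (M * n ^ k)
            ≤⟨ *-monoʳ-≤ (N * B) power≤ ⟩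
          N * B * (suc M * (n P′ k))
            ≡⟨ solve 4 (λ N B M φ → N :* B :* (M :* φ) := M :* (N :* φ :* B)) refl N B (suc M) (n P′ k) ⟩
          suc M * (N * (n P′ k) * B)
            ≤⟨ *-monoʳ-≤ (suc M) (lower-core v) ⟩
          suc M * (x * E * n ^ k)
            ≡⟨ solve 4 (λ M x E P → M :* (x :* E :* P) := M :* x :* E :* P) refl (suc M) x E (n ^ k) ⟩
          suc M * x * E * n ^ k        ∎)
          where
          open ≤-Reasoning
          x = #edges∋ p v
          E = degDen (p v)
          N = degNum (p v)
          B = binom n

  deg≤#edges∋ : ∀ {N} (H : ColHG k r N) (p : Fin N → Fin r) → EdgesTyped H p → ∀ v → deg H v ≤ #edges∋ p v
  deg≤#edges∋ {N} H p typed v = ≤-trans (countᵇ-mono edge-of-some-type (allSubsets N))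
      (countᵇ-anyᵇ (λ e → lookup e v) (λ c → ofType p (T c)) (allSubsets N))
    where
    edge-of-some-type : ∀ e → lookup e v ∧ is-just (col H e) ≡ true → lookup e v ∧ anyᵇ (λ c → ofType p (T c) e) ≡ true
    edge-of-some-type e _ with lookup e v | col H e in colour
    ... | true | just c = anyᵇ-intro _ c (ofType-complete p (T c) e (typed e c colour))

  module Complete {N} (p : Fin N → Fin r) where

    private
      typeIs? : ∀ e c → Dec (∀ i → typeOf p e i ≡ T c i)
      typeIs? e c = all? (λ i → typeOf p e i ≟ T c i)

    colour : Subset N → Maybe (Fin r)
    colour e = witness (any? (typeIs? e))

    colour-type : ∀ e c → colour e ≡ just c → ∀ i → typeOf p e i ≡ T c i
    colour-type e c = witness-sound (any? (typeIs? e))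

    hypergraph : ColHG k r N
    hypergraph = record
      { col     = colour
      ; uniform = λ e c colour≡c → trans (∣∣≡∑typeOf p e) (trans (∑-cong (colour-type e c colour≡c)) (∑T≡k c))
      }

    deg-hypergraph : (∀ c c′ → T c c ≡ T c′ c → c ≡ c′) → ∀ v → deg hypergraph v ≡ #edges∋ p v
    deg-hypergraph distinct v = trans
      (countᵇ-cong (λ e → cong (lookup e v ∧_) (trans (is-just-witness (any? (typeIs? e))) (does-any? (typeIs? e)))) (allSubsets N))
      (countᵇ-anyᵇ-disjoint (λ e → lookup e v) (λ c → ofType p (T c)) (allSubsets N) same-type)
      where
      same-type : ∀ e {c c′} → ofType p (T c) e ≡ true → ofType p (T c′) e ≡ true → c ≡ c′
      same-type e {c} {c′} c-type c′-type = distinct c c′ (trans (sym (ofType-sound p (T c) e c-type c)) (ofType-sound p (T c′) e c′-type c))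

  module Extremal (k>0 : 0 < k) (r>0 : 0 < r) (∑a≡kr : ∑ a ≡ k * r) (distinct : ∀ c c′ → T c c ≡ T c′ c → c ≡ c′)
                  (rr : Fin r) (minimal : ∀ l → S rr * a l ≤ S l * a rr) where

    private
      kr>0 = *-mono-< k>0 r>0

    degDen>0 : ∀ l → 0 < degDen l
    degDen>0 l = *-mono-< (a>0 l) (m^n>0 (k * r) {{>-nonZero kr>0}} k)

    binom>0 : ∀ n → 0 < n → 0 < binom n
    binom>0 n n>0 = C-pos (∸-monoˡ-≤ 1 (begin
      k               ≡⟨ *-identityʳ k ⟨
      k * 1           ≤⟨ *-monoʳ-≤ k (*-mono-≤ r>0 n>0) ⟩
      k * (r * n)     ≡⟨ *-assoc k r n ⟨
      k * r * n       ∎))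
      where open ≤-Reasoning

    ratio-minimal : ∀ l → degNum rr * degDen l ≤ degNum l * degDen rr
    ratio-minimal l = begin
      r * S rr * (a l * (k * r) ^ k)
        ≡⟨ solve 4 (λ r s a K → r :* s :* (a :* K) := r :* K :* (s :* a)) refl r (S rr) (a l) ((k * r) ^ k) ⟩
      r * (k * r) ^ k * (S rr * a l)
        ≤⟨ *-monoʳ-≤ (r * (k * r) ^ k) (minimal l) ⟩
      r * (k * r) ^ k * (S l * a rr)
        ≡⟨ solve 4 (λ r s a K → r :* K :* (s :* a) := r :* s :* (a :* K)) refl r (S l) (a rr) ((k * r) ^ k) ⟩
      r * S l * (a rr * (k * r) ^ k)      ∎
      where open ≤-Reasoning

    module _ (M n : ℕ) (n>0 : 0 < n) (n-large : suc M * (k * k) ≤ n) where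

      private
        part-rr-nonempty : ∀ {p : Fin (k * r * n) → Fin r} → (∀ i → partSize p i ≡ a i * n) → 1 ≤ partSize p rr
        part-rr-nonempty sizes = subst (1 ≤_) (sym (sizes rr)) (*-mono-≤ (a>0 rr) n>0)

      family-upper : ∀ H → Family n H → M * δ₁ H * degDen rr ≤ suc M * degNum rr * binom n
      family-upper H (p , sizes , typed) = begin
        M * δ₁ H * degDen rr
          ≤⟨ *-monoˡ-≤ (degDen rr) (*-monoʳ-≤ M (≤-trans (δ₁≤deg H v) (deg≤#edges∋ H p typed v))) ⟩
        M * #edges∋ p v * degDen rr     ≤⟨ subst (λ l → M * #edges∋ p v * degDen l ≤ suc M * degNum l * binom n) pv≡rr
                                                 (Counting.upper-approx n p sizes k>0 r>0 n>0 M n-large v) ⟩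
        suc M * degNum rr * binom n     ∎
        where
        open ≤-Reasoning
        v     = proj₁ (vertex-in-part p rr (part-rr-nonempty sizes))
        pv≡rr = proj₂ (vertex-in-part p rr (part-rr-nonempty sizes))

      family-lower : Σ (ColHG k r (k * r * n)) λ H → Family n H × M * degNum rr * binom n ≤ suc M * δ₁ H * degDen rr
      family-lower = H , (p , sizes , Complete.colour-type p) , Good-δ₁
        where
        ∑sizes : ∑ (λ i → a i * n) ≡ k * r * n
        ∑sizes = trans (∑-*ʳ n a) (cong (_* n) ∑a≡kr)
        p      = proj₁ (partition-with-sizes (λ i → a i * n) ∑sizes)
        sizes  = proj₂ (partition-with-sizes (λ i → a i * n) ∑sizes)
        H      = Complete.hypergraph p
        Good : ℕ → Set
        Good x = M * degNum rr * binom n ≤ suc M * x * degDen rr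
        Good-mono : ∀ {x y} → x ≤ y → Good x → Good y
        Good-mono x≤y good = ≤-trans good (*-monoˡ-≤ (degDen rr) (*-monoʳ-≤ (suc M) x≤y))
        Good-deg : ∀ v → Good (deg H v)
        Good-deg v = subst Good (sym (Complete.deg-hypergraph p distinct v)) (*-cancelʳ-≤ _ _ (degDen l) {{>-nonZero (degDen>0 l)}} (begin
          M * degNum rr * binom n * degDen l
            ≡⟨ solve 4 (λ M N B E → M :* N :* B :* E := M :* B :* (N :* E)) refl M (degNum rr) (binom n) (degDen l) ⟩
          M * binom n * (degNum rr * degDen l)
            ≤⟨ *-monoʳ-≤ (M * binom n) (ratio-minimal l) ⟩
          M * binom n * (degNum l * degDen rr)
            ≡⟨ solve 4 (λ M B N E → M :* B :* (N :* E) := M :* N :* B :* E) refl M (binom n) (degNum l) (degDen rr) ⟩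
          M * degNum l * binom n * degDen rr
            ≤⟨ *-monoˡ-≤ (degDen rr) (Counting.lower-approx n p sizes k>0 r>0 n>0 M n-large v) ⟩
          suc M * #edges∋ p v * degDen l * degDen rr
            ≡⟨ *-right-comm (suc M * #edges∋ p v) (degDen l) (degDen rr) ⟩
          suc M * #edges∋ p v * degDen rr * degDen l      ∎))
          where
          open ≤-Reasoning
          l = p v
        Good-δ₁ : Good (δ₁ H)
        Good-δ₁ with δ₁-value H
        ... | inj₂ (v , δ₁≡deg) = subst Good (sym δ₁≡deg) (Good-deg v)
        ... | inj₁ δ₁≡2^N = subst Good (sym δ₁≡2^N) (Good-mono (deg≤2^N H v₀) (Good-deg v₀))
          where v₀ = proj₁ (vertex-in-part p rr (part-rr-nonempty sizes))

    limit : LimitOfMax k r Family (degNum rr /ℕ degDen rr)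
    limit ε ε>0 = N₀ , λ n N₀≤n →
      let n>0     = ≤-trans (s≤s z≤n) N₀≤n
          n-large = ≤-trans (n≤1+n _) N₀≤n
          H , family-H , lower = family-lower M n n>0 n-large
      in (λ H′ family-H′ → subst (λ ε → δ₁ H′ /ℕ binom n ℚ.≤ degNum rr /ℕ degDen rr ℚ.+ ε) (sym ε≡p/q)
                              (within-above {δ₁ H′} {binom n} {degNum rr} {degDen rr} {M} {p} {q} (binom>0 n n>0) (degDen>0 rr) q>0
                                  (s≤s z≤n) (family-upper M n n>0 n-large H′ family-H′) small))
         , H , family-H
         , subst (λ ε → degNum rr /ℕ degDen rr ℚ.- ε ℚ.≤ δ₁ H /ℕ binom n) (sym ε≡p/q)
             (within-below {δ₁ H} {binom n} {degNum rr} {degDen rr} {M} {p} {q} (binom>0 n n>0) (degDen>0 rr) q>0 lower small)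
      where
      p = proj₁ (positive-as-/ℕ ε ε>0)
      q = proj₁ (proj₂ (positive-as-/ℕ ε ε>0))
      p>0 = proj₁ (proj₂ (proj₂ (positive-as-/ℕ ε ε>0)))
      q>0 = proj₁ (proj₂ (proj₂ (proj₂ (positive-as-/ℕ ε ε>0))))
      ε≡p/q = proj₂ (proj₂ (proj₂ (proj₂ (positive-as-/ℕ ε ε>0))))
      -- M makes the relative error 1/M of both bounds at most ε / (degNum rr / degDen rr).
      M  = suc (degNum rr * q)
      N₀ = suc (suc M * (k * k))
      small : degNum rr * q ≤ M * p * degDen rr
      small = ≤-trans (n≤1+n _)
          (≤-trans (m≤m*n M (p * degDen rr) {{>-nonZero (*-mono-< p>0 (degDen>0 rr))}}) (≤-reflexive (sym (*-assoc M p (degDen rr)))))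


-- The value of the formula

module FormulaValue (k r : ℕ) (hr : 2 ≤ r) (j : Fin r → ℕ) (σ : Sign) (a w : Fin r → ℕ) (S : ℕ)
  (k>0 : 0 < k) (a>0 : ∀ i → 0 < a i) (a≡rj+σ : ∀ i → ℤ.+ a i ≡ rjσ r (j i) σ)
  (term≡ : ∀ c → term k r (j c) σ ℚ.* ℕ→ℚ (∏ (λ s → a s ^ j s) * (∑ j) !) ≡ ℕ→ℚ (w c * ∏ (λ s → j s !)))
  (S≡ : ℕ→ℚ S ≡ ℕ→ℚ (j (lastIx r hr)) ℚ.* ℕ→ℚ (∑ w) ℚ.+ ℤ→ℚ (σℤ σ) ℚ.* ℕ→ℚ (w (lastIx r hr)))
  where

  private
    rr = lastIx r hr
    Q  = ∏ (λ s → a s ^ j s)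
    W  = ∏ (λ s → j s !)
    K! = (∑ j) !
    Y  = ℕ→ℚ (j rr) ℚ.* Λf k r j σ ℚ.+ ℤ→ℚ (σℤ σ) ℚ.* term k r (j rr) σ

    W>0 : 0 < W
    W>0 = ∏-pos (λ s → j s !) (λ s → 1≤n! (j s))

    QK!>0 : 0 < Q * K!
    QK!>0 = *-mono-< (∏-pos _ (λ i → m^n>0 (a i) {{>-nonZero (a>0 i)}} (j i))) (1≤n! (∑ j))

  D : ℕ
  D = k ^ k * r ^ (k ∸ 1) * a rr

  D>0 : 0 < D
  D>0 = *-mono-< (*-mono-< (m^n>0 k {{>-nonZero k>0}} k) (m^n>0 r {{>-nonZero (≤-trans (s≤s z≤n) hr)}} (k ∸ 1))) (a>0 rr)

  formula≡Π÷D*Y : formula k r hr j σ ≡ (Πf r j σ ÷ ℕ→ℚ D) ℚ.* Y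
  formula≡Π÷D*Y = cong (λ d → (Πf r j σ ÷ ℤ→ℚ d) ℚ.* Y)
    (trans (cong (ℤ.+ (k ^ k * r ^ (k ∸ 1)) ℤ.*_) (sym (a≡rj+σ rr))) (sym (ℤP.pos-* (k ^ k * r ^ (k ∸ 1)) (a rr))))

  Π*W≡K!*Q : Πf r j σ ℚ.* ℕ→ℚ W ≡ ℕ→ℚ (K! * Q)
  Π*W≡K!*Q = begin
    Πf r j σ ℚ.* ℕ→ℚ W
      ≡⟨ cong (ℚ._* ℕ→ℚ W) (cong₂ ℚ._*_ (cong₂ (λ m w → ℕ→ℚ (m !) ÷ ℕ→ℚ w) (sumℕ≡∑ j) (prodℕ≡∏ (λ i → j i !)))
                                        (cong ℤ→ℚ prod≡Q)) ⟩
    K! /ℕ W ℚ.* ℕ→ℚ Q ℚ.* ℕ→ℚ W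
      ≡⟨ solveℚ 3 (λ X Q W → X ⊛ Q ⊛ W ⊜ X ⊛ W ⊛ Q) refl (K! /ℕ W) (ℕ→ℚ Q) (ℕ→ℚ W) ⟩
    K! /ℕ W ℚ.* ℕ→ℚ W ℚ.* ℕ→ℚ Q
      ≡⟨ cong (ℚ._* ℕ→ℚ Q) (/ℕ-*-cancel K! W>0) ⟩
    ℕ→ℚ K! ℚ.* ℕ→ℚ Q
      ≡⟨ ℕ→ℚ-homo-* K! Q ⟨
    ℕ→ℚ (K! * Q)                                    ∎
    where
    open ≡-Reasoning
    prod≡Q : prodℤ (λ s → rjσ r (j s) σ ℤ.^ j s) ≡ ℤ.+ Q
    prod≡Q = prodℤ≡+∏ _ _ (λ s → trans (cong (ℤ._^ j s) (sym (a≡rj+σ s))) (pos-^ (a s) (j s)))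

  Λ*Q*K!≡ : Λf k r j σ ℚ.* ℕ→ℚ (Q * K!) ≡ ℕ→ℚ (∑ w * W)
  Λ*Q*K!≡ = begin
    Λf k r j σ ℚ.* ℕ→ℚ (Q * K!)                     ≡⟨ sumℚ-*ʳ (λ c → term k r (j c) σ) (ℕ→ℚ (Q * K!)) ⟩
    sumℚ (λ c → term k r (j c) σ ℚ.* ℕ→ℚ (Q * K!))  ≡⟨ sumℚ-cong term≡ ⟩
    sumℚ (λ c → ℕ→ℚ (w c * W))                      ≡⟨ sumℚ-ℕ→ℚ (λ c → w c * W) ⟩
    ℕ→ℚ (∑ (λ c → w c * W))                         ≡⟨ cong ℕ→ℚ (∑-*ʳ W w) ⟩
    ℕ→ℚ (∑ w * W)                                   ∎
    where open ≡-Reasoning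

  Y*Q*K!≡S*W : Y ℚ.* ℕ→ℚ (Q * K!) ≡ ℕ→ℚ (S * W)
  Y*Q*K!≡S*W = begin
    Y ℚ.* QK!
      ≡⟨ solveℚ 5 (λ J L s t X → (J ⊛ L ⊕ s ⊛ t) ⊛ X ⊜ J ⊛ (L ⊛ X) ⊕ s ⊛ (t ⊛ X))
           refl (ℕ→ℚ (j rr)) (Λf k r j σ) (ℤ→ℚ (σℤ σ)) (term k r (j rr) σ) QK! ⟩
    ℕ→ℚ (j rr) ℚ.* (Λf k r j σ ℚ.* QK!) ℚ.+ ℤ→ℚ (σℤ σ) ℚ.* (term k r (j rr) σ ℚ.* QK!)
      ≡⟨ cong₂ (λ x y → ℕ→ℚ (j rr) ℚ.* x ℚ.+ ℤ→ℚ (σℤ σ) ℚ.* y)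
               (trans Λ*Q*K!≡ (ℕ→ℚ-homo-* (∑ w) W)) (trans (term≡ rr) (ℕ→ℚ-homo-* (w rr) W)) ⟩
    ℕ→ℚ (j rr) ℚ.* (ℕ→ℚ (∑ w) ℚ.* ℕ→ℚ W) ℚ.+ ℤ→ℚ (σℤ σ) ℚ.* (ℕ→ℚ (w rr) ℚ.* ℕ→ℚ W)
      ≡⟨ solveℚ 5 (λ J H s h W → J ⊛ (H ⊛ W) ⊕ s ⊛ (h ⊛ W) ⊜ (J ⊛ H ⊕ s ⊛ h) ⊛ W)
           refl (ℕ→ℚ (j rr)) (ℕ→ℚ (∑ w)) (ℤ→ℚ (σℤ σ)) (ℕ→ℚ (w rr)) (ℕ→ℚ W) ⟩
    (ℕ→ℚ (j rr) ℚ.* ℕ→ℚ (∑ w) ℚ.+ ℤ→ℚ (σℤ σ) ℚ.* ℕ→ℚ (w rr)) ℚ.* ℕ→ℚ W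
      ≡⟨ cong (ℚ._* ℕ→ℚ W) S≡ ⟨
    ℕ→ℚ S ℚ.* ℕ→ℚ W
      ≡⟨ ℕ→ℚ-homo-* S W ⟨
    ℕ→ℚ (S * W) ∎
    where
    open ≡-Reasoning
    QK! = ℕ→ℚ (Q * K!)

  Π*Y≡S : Πf r j σ ℚ.* Y ≡ ℕ→ℚ S
  Π*Y≡S = ℚ-*-cancelʳ (ℕ→ℚ≢0 (*-mono-< W>0 QK!>0)) (begin
    Πf r j σ ℚ.* Y ℚ.* ℕ→ℚ (W * (Q * K!))
      ≡⟨ cong (Πf r j σ ℚ.* Y ℚ.*_) (ℕ→ℚ-homo-* W (Q * K!)) ⟩
    Πf r j σ ℚ.* Y ℚ.* (ℕ→ℚ W ℚ.* ℕ→ℚ (Q * K!))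
      ≡⟨ solveℚ 4 (λ P Y W X → P ⊛ Y ⊛ (W ⊛ X) ⊜ P ⊛ W ⊛ (Y ⊛ X)) refl (Πf r j σ) Y (ℕ→ℚ W) (ℕ→ℚ (Q * K!)) ⟩
    Πf r j σ ℚ.* ℕ→ℚ W ℚ.* (Y ℚ.* ℕ→ℚ (Q * K!))
      ≡⟨ cong₂ ℚ._*_ Π*W≡K!*Q Y*Q*K!≡S*W ⟩
    ℕ→ℚ (K! * Q) ℚ.* ℕ→ℚ (S * W)
      ≡⟨ ℕ→ℚ-homo-* (K! * Q) (S * W) ⟨
    ℕ→ℚ (K! * Q * (S * W))
      ≡⟨ cong ℕ→ℚ (solve 4 (λ K Q S W → K :* Q :* (S :* W) := S :* (W :* (Q :* K))) refl K! Q S W) ⟩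
    ℕ→ℚ (S * (W * (Q * K!)))
      ≡⟨ ℕ→ℚ-homo-* S (W * (Q * K!)) ⟩
    ℕ→ℚ S ℚ.* ℕ→ℚ (W * (Q * K!))                         ∎)
    where open ≡-Reasoning

  formula*D≡S : formula k r hr j σ ℚ.* ℕ→ℚ D ≡ ℕ→ℚ S
  formula*D≡S = begin
    formula k r hr j σ ℚ.* ℕ→ℚ D
      ≡⟨ cong (ℚ._* ℕ→ℚ D) formula≡Π÷D*Y ⟩
    (Πf r j σ ÷ ℕ→ℚ D) ℚ.* Y ℚ.* ℕ→ℚ D
      ≡⟨ solveℚ 3 (λ X Y D → X ⊛ Y ⊛ D ⊜ X ⊛ D ⊛ Y) refl (Πf r j σ ÷ ℕ→ℚ D) Y (ℕ→ℚ D) ⟩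
    (Πf r j σ ÷ ℕ→ℚ D) ℚ.* ℕ→ℚ D ℚ.* Y
      ≡⟨ cong (ℚ._* Y) (÷-*-cancel (ℕ→ℚ≢0 D>0) (Πf r j σ)) ⟩
    Πf r j σ ℚ.* Y
      ≡⟨ Π*Y≡S ⟩
    ℕ→ℚ S                                     ∎
    where open ≡-Reasoning

  r*D≡ : r * D ≡ a rr * (k * r) ^ k
  r*D≡ = helper k k>0
    where
    helper : ∀ k → 0 < k → r * (k ^ k * r ^ (k ∸ 1) * a rr) ≡ a rr * (k * r) ^ k
    helper (suc k) _ = trans (solve 4 (λ r K R A → r :* (K :* R :* A) := A :* (K :* (r :* R))) refl r (suc k ^ suc k) (r ^ k) (a rr))
                             (cong (a rr *_) (sym (^-distribʳ-* (suc k) r (suc k))))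

  formula≡ : formula k r hr j σ ≡ (r * S) /ℕ (a rr * (k * r) ^ k)
  formula≡ = begin
    formula k r hr j σ                       ≡⟨ ÷-unique (ℕ→ℚ≢0 D>0) formula*D≡S ⟨
    S /ℕ D                                   ≡⟨ /ℕ-cancelˡ r S (≤-trans (s≤s z≤n) hr) D>0 ⟨
    (r * S) /ℕ (r * D)                       ≡⟨ cong ((r * S) /ℕ_) r*D≡ ⟩
    (r * S) /ℕ (a rr * (k * r) ^ k)          ∎
    where open ≡-Reasoning


-- The paper's part sizes r j_i + σ and colour types j + σ e_c, as natural numbers.
record Realisation (k r : ℕ) (hk : 2 ≤ k) (hr : 2 ≤ r) (j : Fin r → ℕ) (σ : Sign) : Set where
  field
    a        : Fin r → ℕ
    T        : Fin r → Fin r → ℕ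
    a≡rj+σ   : ∀ i → ℤ.+ a i ≡ rjσ r (j i) σ
    T≡j+σe   : ∀ c i → ℤ.+ T c i ≡ ℤ.+ j i ℤ.+ (if ⌊ i Fin.≟ c ⌋ then σℤ σ else ℤ.0ℤ)
    ∑T≡k     : ∀ c → ∑ (T c) ≡ k
    a>0      : ∀ i → 0 < a i
    ∑a≡kr    : ∑ a ≡ k * r
    distinct : ∀ c c′ → T c c ≡ T c′ c → c ≡ c′

  open TypedFamily k r a T ∑T≡k a>0 public

  field
    minimal  : ∀ l → S (lastIx r hr) * a l ≤ S l * a (lastIx r hr)
    formula≡ : formula k r hr j σ ≡ degNum (lastIx r hr) /ℕ degDen (lastIx r hr)

  InFamily→Family : ∀ n H → InFamily k r j σ n H → Family n H
  InFamily→Family n H (p , sizes , types) =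
    p , (λ i → ℤP.+-injective (trans (sizes i) (trans (cong (ℤ._* ℤ.+ n) (sym (a≡rj+σ i))) (sym (ℤP.pos-* (a i) n))))) ,
        (λ e c col≡c i → ℤP.+-injective (trans (types e c col≡c i) (sym (T≡j+σe c i))))

  Family→InFamily : ∀ n H → Family n H → InFamily k r j σ n H
  Family→InFamily n H (p , sizes , types) =
    p , (λ i → trans (cong ℤ.+_ (sizes i)) (trans (ℤP.pos-* (a i) n) (cong (ℤ._* ℤ.+ n) (a≡rj+σ i)))) ,
        (λ e c col≡c i → trans (cong ℤ.+_ (types e c col≡c i)) (T≡j+σe c i))

  limit : LimitOfMaxIs k r j σ (formula k r hr j σ)
  limit = subst (LimitOfMax k r (InFamily k r j σ)) (sym formula≡)
    (LimitOfMax-⇔ {L = degNum (lastIx r hr) /ℕ degDen (lastIx r hr)} Family→InFamily InFamily→Family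
      (Extremal.limit (≤-trans (s≤s z≤n) hk) (≤-trans (s≤s z≤n) hr) ∑a≡kr distinct (lastIx r hr) minimal))

module Positive (k r : ℕ) (hk : 2 ≤ k) (hr : 2 ≤ r) (j : Fin r → ℕ)
                (∑j+1≡k : suc (∑ j) ≡ k) (j-min : ∀ l → j (lastIx r hr) ≤ j l) where

  rr = lastIx r hr

  a : Fin r → ℕ
  a i = r * j i + 1

  T : Fin r → Fin r → ℕ
  T c i = j i + δ c i

  a>0 : ∀ i → 0 < a i
  a>0 i = m≤n+m 1 (r * j i)

  ∑T≡k : ∀ c → ∑ (T c) ≡ k
  ∑T≡k c = trans (∑-distrib-+ j (δ c)) (trans (cong (∑ j +_) (∑-δ c)) (trans (+-comm (∑ j) 1) ∑j+1≡k))

  ∑a≡kr : ∑ a ≡ k * r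
  ∑a≡kr = begin
    ∑ a                                  ≡⟨ ∑-distrib-+ (λ i → r * j i) (λ _ → 1) ⟩
    ∑ (λ i → r * j i) + ∑ {r} (λ _ → 1)  ≡⟨ cong₂ _+_ (∑-*ˡ r j) (trans (∑-const r 1) (*-identityʳ r)) ⟩
    r * ∑ j + r                          ≡⟨ solve 2 (λ r s → r :* s :+ r := (con 1 :+ s) :* r) refl r (∑ j) ⟩
    suc (∑ j) * r                        ≡⟨ cong (_* r) ∑j+1≡k ⟩
    k * r                                ∎
    where open ≡-Reasoning

  T-here : ∀ c → T c c ≡ suc (j c)
  T-here c = trans (cong (j c +_) (δ-diag c)) (+-comm (j c) 1)

  T-off : ∀ {c s} → c ≢ s → T c s ≡ j s
  T-off {c} {s} c≢s = trans (cong (j s +_) (δ-off c≢s)) (+-identityʳ (j s))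

  distinct : ∀ c c′ → T c c ≡ T c′ c → c ≡ c′
  distinct c c′ T≡ = by (c′ Fin.≟ c)
    where
    by : Dec (c′ ≡ c) → c ≡ c′
    by (yes c′≡c) = sym c′≡c
    by (no c′≢c)  = contradiction (trans (sym (T-here c)) (trans T≡ (T-off c′≢c))) (1+n≢n {j c})

  open TypedFamily k r a T ∑T≡k a>0 using (∏a^T; ∏T!; multinomialOf; multinomialOf-spec; weight; S)

  ∏a^j ∏j! : ℕ
  ∏a^j = ∏ (λ s → a s ^ j s)
  ∏j!  = ∏ (λ s → j s !)

  weight-spec : ∀ c → weight c * suc (j c) * ∏j! ≡ a c * ∏a^j * k !
  weight-spec c = begin
    ∏a^T c * multinomialOf c * suc (j c) * ∏j!
      ≡⟨ solve 4 (λ q m s w → q :* m :* s :* w := q :* (m :* (w :* s))) refl (∏a^T c) (multinomialOf c) (suc (j c)) ∏j! ⟩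
    ∏a^T c * (multinomialOf c * (∏j! * suc (j c)))
      ≡⟨ cong (λ x → ∏a^T c * (multinomialOf c * x)) (sym ∏T!≡) ⟩
    ∏a^T c * (multinomialOf c * ∏T! c)
      ≡⟨ cong (∏a^T c *_) (multinomialOf-spec c) ⟩
    ∏a^T c * k !
      ≡⟨ cong (_* k !) ∏a^T≡ ⟩
    a c * ∏a^j * k !                                          ∎
    where
    open ≡-Reasoning
    ∏a^T≡ : ∏a^T c ≡ a c * ∏a^j
    ∏a^T≡ = trans (sym (*-identityʳ (∏a^T c))) (trans (∏-scale-at c (λ s c≢s → cong (a s ^_) (T-off c≢s))
              (trans (*-identityʳ _) (trans (cong (a c ^_) (T-here c)) (*-comm (a c) (a c ^ j c))))) (*-comm ∏a^j (a c)))
    ∏T!≡ : ∏T! c ≡ ∏j! * suc (j c)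
    ∏T!≡ = trans (sym (*-identityʳ (∏T! c))) (∏-scale-at c (λ s c≢s → cong _! (T-off c≢s))
              (trans (*-identityʳ _) (trans (cong _! (T-here c)) (*-comm (suc (j c)) (j c !)))))

  S≡ : ∀ l → S l ≡ j l * ∑ weight + weight l
  S≡ l = begin
    ∑ (λ c → (j l + δ c l) * weight c)
      ≡⟨ ∑-cong (λ c → *-distribʳ-+ (weight c) (j l) (δ c l)) ⟩
    ∑ (λ c → j l * weight c + δ c l * weight c)
      ≡⟨ ∑-distrib-+ (λ c → j l * weight c) (λ c → δ c l * weight c) ⟩
    ∑ (λ c → j l * weight c) + ∑ (λ c → δ c l * weight c)
      ≡⟨ cong₂ _+_ (∑-*ˡ (j l) weight) (∑-δ-* l weight) ⟩
    j l * ∑ weight + weight l                                 ∎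
    where open ≡-Reasoning

  private
    r≥1 : 1 ≤ r
    r≥1 = ≤-trans (s≤s z≤n) hr

    [ry+1][z+1]≤[rz+1][y+1] : ∀ {y z} → y ≤ z → (r * y + 1) * suc z ≤ (r * z + 1) * suc y
    [ry+1][z+1]≤[rz+1][y+1] {y} {z} y≤z = subst (λ z → (r * y + 1) * suc z ≤ (r * z + 1) * suc y) (m+[n∸m]≡n y≤z) (begin
      (r * y + 1) * suc (y + d)
        ≡⟨ solve 3 (λ r y d → (r :* y :+ con 1) :* (con 1 :+ (y :+ d)) := (r :* y :+ con 1) :* (con 1 :+ y) :+ (r :* y :* d :+ d))
             refl r y d ⟩
      (r * y + 1) * suc y + (r * y * d + d)
        ≤⟨ +-monoʳ-≤ ((r * y + 1) * suc y) (+-monoʳ-≤ (r * y * d) (m≤n*m d r {{>-nonZero r≥1}})) ⟩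
      (r * y + 1) * suc y + (r * y * d + r * d)
        ≡⟨ solve 3 (λ r y d → (r :* y :+ con 1) :* (con 1 :+ y) :+ (r :* y :* d :+ r :* d) := (r :* (y :+ d) :+ con 1) :* (con 1 :+ y))
             refl r y d ⟩
      (r * (y + d) + 1) * suc y                       ∎)
      where
      open ≤-Reasoning
      d = z ∸ y

  -- weight c is proportional to (r j_c + 1) / (j_c + 1), which increases with j_c.
  weight-min : ∀ c → weight rr ≤ weight c
  weight-min c = *-cancelʳ-≤ (weight rr) (weight c) (K rr * K c) {{>-nonZero (*-mono-< (K>0 rr) (K>0 c))}} (begin
    weight rr * (K rr * K c)
      ≡⟨ solve 4 (λ w s W K → w :* (s :* W :* K) := w :* s :* W :* K) refl (weight rr) (suc (j rr)) ∏j! (K c) ⟩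
    weight rr * suc (j rr) * ∏j! * K c
      ≡⟨ cong (_* K c) (weight-spec rr) ⟩
    a rr * ∏a^j * k ! * (suc (j c) * ∏j!)
      ≡⟨ solve 5 (λ a Q f s W → a :* Q :* f :* (s :* W) := Q :* f :* W :* (a :* s)) refl (a rr) ∏a^j (k !) (suc (j c)) ∏j! ⟩
    ∏a^j * k ! * ∏j! * (a rr * suc (j c))
      ≤⟨ *-monoʳ-≤ (∏a^j * k ! * ∏j!) ([ry+1][z+1]≤[rz+1][y+1] (j-min c)) ⟩
    ∏a^j * k ! * ∏j! * (a c * suc (j rr))
      ≡⟨ solve 5 (λ a Q f s W → Q :* f :* W :* (a :* s) := a :* Q :* f :* (s :* W)) refl (a c) ∏a^j (k !) (suc (j rr)) ∏j! ⟩
    a c * ∏a^j * k ! * (suc (j rr) * ∏j!)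
      ≡⟨ cong (_* K rr) (weight-spec c) ⟨
    weight c * suc (j c) * ∏j! * K rr
      ≡⟨ solve 4 (λ w s W K → w :* s :* W :* K := w :* (K :* (s :* W))) refl (weight c) (suc (j c)) ∏j! (K rr) ⟩
    weight c * (K rr * K c)                   ∎)
    where
    open ≤-Reasoning
    K : Fin r → ℕ
    K i = suc (j i) * ∏j!
    K>0 : ∀ i → 0 < K i
    K>0 i = *-mono-< (s≤s (z≤n {j i})) (∏-pos (λ s → j s !) (λ s → 1≤n! (j s)))

  private
    cross-bound : ∀ {y d H w w′} → r * w ≤ H → w ≤ w′ →
      (y * H + w) * (r * (y + d) + 1) ≤ ((y + d) * H + w′) * (r * y + 1)
    cross-bound {y} {d} {H} {w} {w′} rw≤H w≤w′ = begin
      (y * H + w) * (r * (y + d) + 1)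
        ≡⟨ solve 5 (λ y d H h r → (y :* H :+ h) :* (r :* (y :+ d) :+ con 1)
                                  := y :* H :* (r :* y :+ con 1) :+ d :* H :* r :* y :+ (h :* (r :* y :+ con 1) :+ d :* (r :* h)))
                   refl y d H w r ⟩
      y * H * (r * y + 1) + d * H * r * y + (w * (r * y + 1) + d * (r * w))
        ≤⟨ +-monoʳ-≤ (y * H * (r * y + 1) + d * H * r * y) (+-mono-≤ (*-monoˡ-≤ (r * y + 1) w≤w′) (*-monoʳ-≤ d rw≤H)) ⟩
      y * H * (r * y + 1) + d * H * r * y + (w′ * (r * y + 1) + d * H)
        ≡⟨ solve 5 (λ y d H h r → y :* H :* (r :* y :+ con 1) :+ d :* H :* r :* y :+ (h :* (r :* y :+ con 1) :+ d :* H)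
                                  := ((y :+ d) :* H :+ h) :* (r :* y :+ con 1))
                   refl y d H w′ r ⟩
      ((y + d) * H + w′) * (r * y + 1)
        ∎
      where open ≤-Reasoning

  minimal : ∀ l → S rr * a l ≤ S l * a rr
  minimal l = begin
    S rr * a l                                      ≡⟨ cong₂ _*_ (S≡ rr) (cong (λ z → r * z + 1) (sym y+d≡z)) ⟩
    (j rr * H + weight rr) * (r * (j rr + d) + 1)    ≤⟨ cross-bound {j rr} {d} rw≤H (weight-min l) ⟩
    ((j rr + d) * H + weight l) * a rr              ≡⟨ cong (_* a rr) (trans (cong (λ z → z * H + weight l) y+d≡z) (sym (S≡ l))) ⟩
    S l * a rr                                      ∎
    where
    open ≤-Reasoning
    d = j l ∸ j rr
    y+d≡z : j rr + d ≡ j l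
    y+d≡z = m+[n∸m]≡n (j-min l)
    H = ∑ weight
    rw≤H : r * weight rr ≤ H
    rw≤H = subst (_≤ H) (∑-const r (weight rr)) (∑-mono-≤ {f = λ _ → weight rr} weight-min)

  term≡ : ∀ c → term k r (j c) Sign.+ ℚ.* ℕ→ℚ (∏a^j * (∑ j) !) ≡ ℕ→ℚ (weight c * ∏j!)
  term≡ c = trans (cong (ℚ._* ℕ→ℚ (∏a^j * (∑ j) !)) (cong₂ (λ x y → ℤ→ℚ x ÷ ℤ→ℚ y) numerator denominator))
                  (/ℕ-*-≡ {2 * k * a c} {2 * suc (j c)} {∏a^j * (∑ j) !} {weight c * ∏j!} (s≤s z≤n) cross)
    where
    numerator : (ℤ.+ (2 * k + 1) ℤ.- ℤ.1ℤ) ℤ.* (ℤ.+ (r * j c) ℤ.+ ℤ.1ℤ) ≡ ℤ.+ (2 * k * a c)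
    numerator = trans (cong₂ ℤ._*_ (+[m+1]-1 (2 * k)) (sym (ℤP.pos-+ (r * j c) 1))) (sym (ℤP.pos-* (2 * k) (a c)))
    denominator : ℤ.+ (2 * j c + 1) ℤ.+ ℤ.1ℤ ≡ ℤ.+ (2 * suc (j c))
    denominator = trans (sym (ℤP.pos-+ (2 * j c + 1) 1)) (cong ℤ.+_ (solve 1 (λ x → con 2 :* x :+ con 1 :+ con 1 := con 2 :* (con 1 :+ x))
                                                                       refl (j c)))
    cross : 2 * k * a c * (∏a^j * (∑ j) !) ≡ weight c * ∏j! * (2 * suc (j c))
    cross = begin
      2 * k * a c * (∏a^j * (∑ j) !)
        ≡⟨ solve 4 (λ k a Q f → con 2 :* k :* a :* (Q :* f) := con 2 :* (a :* Q :* (k :* f))) refl k (a c) ∏a^j ((∑ j) !) ⟩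
      2 * (a c * ∏a^j * (k * (∑ j) !))
        ≡⟨ cong (λ x → 2 * (a c * ∏a^j * x)) (subst (λ m → m * (∑ j) ! ≡ m !) ∑j+1≡k refl) ⟩
      2 * (a c * ∏a^j * k !)
        ≡⟨ cong (2 *_) (weight-spec c) ⟨
      2 * (weight c * suc (j c) * ∏j!)
        ≡⟨ solve 3 (λ w s W → con 2 :* (w :* s :* W) := w :* W :* (con 2 :* s)) refl (weight c) (suc (j c)) ∏j! ⟩
      weight c * ∏j! * (2 * suc (j c))     ∎
      where open ≡-Reasoning

  S≡ℚ : ℕ→ℚ (S rr) ≡ ℕ→ℚ (j rr) ℚ.* ℕ→ℚ (∑ weight) ℚ.+ ℤ→ℚ (σℤ Sign.+) ℚ.* ℕ→ℚ (weight rr)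
  S≡ℚ = trans (cong ℕ→ℚ (S≡ rr)) (trans (ℕ→ℚ-homo-+ (j rr * ∑ weight) (weight rr))
          (cong₂ ℚ._+_ (ℕ→ℚ-homo-* (j rr) (∑ weight)) (sym (ℚP.*-identityˡ (ℕ→ℚ (weight rr))))))

  T≡j+e : ∀ c i → ℤ.+ T c i ≡ ℤ.+ j i ℤ.+ (if ⌊ i Fin.≟ c ⌋ then ℤ.1ℤ else ℤ.0ℤ)
  T≡j+e c i = by (i Fin.≟ c)
    where
    by : (i≟c : Dec (i ≡ c)) → ℤ.+ T c i ≡ ℤ.+ j i ℤ.+ (if ⌊ i≟c ⌋ then ℤ.1ℤ else ℤ.0ℤ)
    by (yes refl) = trans (cong (λ x → ℤ.+ (j i + x)) (δ-diag i)) (ℤP.pos-+ (j i) 1)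
    by (no i≢c)   = trans (cong (λ x → ℤ.+ (j i + x)) (δ-off (i≢c ∘ sym))) (ℤP.pos-+ (j i) 0)

  realisation : Realisation k r hk hr j Sign.+
  realisation = record
    { a        = a
    ; T        = T
    ; a≡rj+σ   = a≡rj+1
    ; T≡j+σe   = T≡j+e
    ; ∑T≡k     = ∑T≡k
    ; a>0      = a>0
    ; ∑a≡kr    = ∑a≡kr
    ; distinct = distinct
    ; minimal  = minimal
    ; formula≡ = FormulaValue.formula≡ k r hr j Sign.+ a weight (S rr) (≤-trans (s≤s z≤n) hk) a>0 a≡rj+1 term≡ S≡ℚ
    }
    where
    a≡rj+1 : ∀ i → ℤ.+ a i ≡ rjσ r (j i) Sign.+
    a≡rj+1 i = ℤP.pos-+ (r * j i) 1

module Negative (k r : ℕ) (hk : 2 ≤ k) (hr : 2 ≤ r) (j : Fin r → ℕ)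
                (∑j≡k+1 : ∑ j ≡ suc k) (j>0 : ∀ i → 0 < j i) (j-min : ∀ l → j (lastIx r hr) ≤ j l) where

  rr = lastIx r hr

  a : Fin r → ℕ
  a i = r * j i ∸ 1

  T : Fin r → Fin r → ℕ
  T c i = j i ∸ δ c i

  rj≥2 : ∀ i → 2 ≤ r * j i
  rj≥2 i = *-mono-≤ hr (j>0 i)

  a+1≡rj : ∀ i → a i + 1 ≡ r * j i
  a+1≡rj i = m∸n+n≡m (≤-trans (s≤s z≤n) (rj≥2 i))

  a>0 : ∀ i → 0 < a i
  a>0 i = ∸-monoˡ-≤ 1 (rj≥2 i)

  T-here : ∀ c → T c c + 1 ≡ j c
  T-here c = trans (cong (λ x → j c ∸ x + 1) (δ-diag c)) (m∸n+n≡m (j>0 c))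

  1+T≡j : ∀ c → suc (T c c) ≡ j c
  1+T≡j c = trans (+-comm 1 (T c c)) (T-here c)

  T-off : ∀ {c s} → c ≢ s → T c s ≡ j s
  T-off {c} {s} c≢s = cong (j s ∸_) (δ-off c≢s)

  T+δ≡j : ∀ c i → T c i + δ c i ≡ j i
  T+δ≡j c = cases-at c (trans (cong (T c c +_) (δ-diag c)) (T-here c)) (λ c≢s → trans (cong₂ _+_ (T-off c≢s) (δ-off c≢s)) (+-identityʳ _))

  ∑T≡k : ∀ c → ∑ (T c) ≡ k
  ∑T≡k c = suc-injective (begin
    suc (∑ (T c))                   ≡⟨ +-comm 1 (∑ (T c)) ⟩
    ∑ (T c) + 1                     ≡⟨ cong (∑ (T c) +_) (∑-δ c) ⟨
    ∑ (T c) + ∑ (δ c)               ≡⟨ ∑-distrib-+ (T c) (δ c) ⟨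
    ∑ (λ i → T c i + δ c i)         ≡⟨ ∑-cong (T+δ≡j c) ⟩
    ∑ j                             ≡⟨ ∑j≡k+1 ⟩
    suc k                           ∎)
    where open ≡-Reasoning

  ∑a≡kr : ∑ a ≡ k * r
  ∑a≡kr = +-cancelʳ-≡ r (∑ a) (k * r) (begin
    ∑ a + r                          ≡⟨ cong (∑ a +_) (trans (∑-const r 1) (*-identityʳ r)) ⟨
    ∑ a + ∑ {r} (λ _ → 1)             ≡⟨ ∑-distrib-+ a (λ _ → 1) ⟨
    ∑ (λ i → a i + 1)                ≡⟨ ∑-cong a+1≡rj ⟩
    ∑ (λ i → r * j i)                ≡⟨ ∑-*ˡ r j ⟩
    r * ∑ j                          ≡⟨ cong (r *_) ∑j≡k+1 ⟩
    r * suc k                        ≡⟨ solve 2 (λ r k → r :* (con 1 :+ k) := k :* r :+ r) refl r k ⟩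
    k * r + r                        ∎)
    where open ≡-Reasoning

  distinct : ∀ c c′ → T c c ≡ T c′ c → c ≡ c′
  distinct c c′ T≡ = by (c′ Fin.≟ c)
    where
    by : Dec (c′ ≡ c) → c ≡ c′
    by (yes c′≡c) = sym c′≡c
    by (no c′≢c)  = contradiction (trans (sym (cong suc (trans T≡ (T-off c′≢c)))) (1+T≡j c)) (1+n≢n {j c})

  open TypedFamily k r a T ∑T≡k a>0 using (∏a^T; ∏T!; multinomialOf; multinomialOf-spec; weight; S)

  ∏a^j ∏j! : ℕ
  ∏a^j = ∏ (λ s → a s ^ j s)
  ∏j!  = ∏ (λ s → j s !)

  weight-spec : ∀ c → weight c * a c * ∏j! ≡ j c * ∏a^j * k !
  weight-spec c = begin
    ∏a^T c * multinomialOf c * a c * ∏j!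
      ≡⟨ cong (λ x → ∏a^T c * multinomialOf c * a c * x) ∏T!≡ ⟨
    ∏a^T c * multinomialOf c * a c * (∏T! c * j c)
      ≡⟨ solve 5 (λ q m a t j → q :* m :* a :* (t :* j) := j :* (q :* a) :* (m :* t)) refl (∏a^T c) (multinomialOf c) (a c) (∏T! c) (j c) ⟩
    j c * (∏a^T c * a c) * (multinomialOf c * ∏T! c)
      ≡⟨ cong₂ (λ x y → j c * x * y) ∏a^T≡ (multinomialOf-spec c) ⟩
    j c * ∏a^j * k !                                      ∎
    where
    open ≡-Reasoning
    ∏a^T≡ : ∏a^T c * a c ≡ ∏a^j
    ∏a^T≡ = trans (∏-scale-at c (λ s c≢s → cong (a s ^_) (T-off c≢s))
              (trans (*-comm (a c ^ T c c) (a c)) (trans (cong (a c ^_) (1+T≡j c)) (sym (*-identityʳ _))))) (*-identityʳ ∏a^j)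
    ∏T!≡ : ∏T! c * j c ≡ ∏j!
    ∏T!≡ = trans (∏-scale-at c (λ s c≢s → cong _! (T-off c≢s))
              (trans (cong (T c c ! *_) (sym (1+T≡j c)))
                  (trans (*-comm (T c c !) (suc (T c c))) (trans (cong _! (1+T≡j c)) (sym (*-identityʳ _)))))) (*-identityʳ ∏j!)

  S+weight≡ : ∀ l → S l + weight l ≡ j l * ∑ weight
  S+weight≡ l = begin
    S l + weight l
      ≡⟨ cong (S l +_) (∑-δ-* l weight) ⟨
    S l + ∑ (λ c → δ c l * weight c)
      ≡⟨ ∑-distrib-+ (λ c → T c l * weight c) (λ c → δ c l * weight c) ⟨
    ∑ (λ c → T c l * weight c + δ c l * weight c)
      ≡⟨ ∑-cong (λ c → trans (sym (*-distribʳ-+ (weight c) (T c l) (δ c l))) (cong (_* weight c) (T+δ≡j c l))) ⟩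
    ∑ (λ c → j l * weight c)
      ≡⟨ ∑-*ˡ (j l) weight ⟩
    j l * ∑ weight                                          ∎
    where open ≡-Reasoning

  -- weight c is proportional to j_c / (r j_c − 1), which decreases with j_c.
  weight-max : ∀ c → weight c ≤ weight rr
  weight-max c = *-cancelʳ-≤ (weight c) (weight rr) (K rr * K c) {{>-nonZero (*-mono-< (K>0 rr) (K>0 c))}} (begin
    weight c * (K rr * K c)
      ≡⟨ solve 4 (λ w a W K → w :* (K :* (a :* W)) := w :* a :* W :* K) refl (weight c) (a c) ∏j! (K rr) ⟩
    weight c * a c * ∏j! * K rr
      ≡⟨ cong (_* K rr) (weight-spec c) ⟩
    j c * ∏a^j * k ! * (a rr * ∏j!)
      ≡⟨ solve 5 (λ x Q f a W → x :* Q :* f :* (a :* W) := Q :* f :* W :* (x :* a)) refl (j c) ∏a^j (k !) (a rr) ∏j! ⟩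
    ∏a^j * k ! * ∏j! * (j c * a rr)
      ≤⟨ *-monoʳ-≤ (∏a^j * k ! * ∏j!) (j[rj′-1]≤j′[rj-1] (j-min c)) ⟩
    ∏a^j * k ! * ∏j! * (j rr * a c)
      ≡⟨ solve 5 (λ x Q f a W → Q :* f :* W :* (x :* a) := x :* Q :* f :* (a :* W)) refl (j rr) ∏a^j (k !) (a c) ∏j! ⟩
    j rr * ∏a^j * k ! * (a c * ∏j!)
      ≡⟨ cong (_* K c) (weight-spec rr) ⟨
    weight rr * a rr * ∏j! * K c
      ≡⟨ solve 4 (λ w a W K → w :* a :* W :* K := w :* (a :* W :* K)) refl (weight rr) (a rr) ∏j! (K c) ⟩
    weight rr * (K rr * K c)                  ∎)
    where
    open ≤-Reasoning
    K : Fin r → ℕ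
    K i = a i * ∏j!
    K>0 : ∀ i → 0 < K i
    K>0 i = *-mono-< (a>0 i) (∏-pos (λ s → j s !) (λ s → 1≤n! (j s)))
    j[rj′-1]≤j′[rj-1] : ∀ {y z} → y ≤ z → z * (r * y ∸ 1) ≤ y * (r * z ∸ 1)
    j[rj′-1]≤j′[rj-1] {y} {z} y≤z = begin
      z * (r * y ∸ 1)
        ≡⟨ *-distribˡ-∸ z (r * y) 1 ⟩
      z * (r * y) ∸ z * 1
        ≤⟨ ∸-mono (≤-reflexive (solve 3 (λ z r y → z :* (r :* y) := y :* (r :* z)) refl z r y)) (*-monoˡ-≤ 1 y≤z) ⟩
      y * (r * z) ∸ y * 1
        ≡⟨ *-distribˡ-∸ y (r * z) 1 ⟨
      y * (r * z ∸ 1)         ∎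

  a≡a-rr+r*Δj : ∀ l → a l ≡ a rr + r * (j l ∸ j rr)
  a≡a-rr+r*Δj l = +-cancelʳ-≡ 1 (a l) (A + r * d) (begin
    a l + 1               ≡⟨ a+1≡rj l ⟩
    r * j l               ≡⟨ cong (r *_) (m+[n∸m]≡n (j-min l)) ⟨
    r * (j rr + d)        ≡⟨ *-distribˡ-+ r (j rr) d ⟩
    r * j rr + r * d      ≡⟨ cong (_+ r * d) (a+1≡rj rr) ⟨
    A + 1 + r * d         ≡⟨ solve 3 (λ A x y → A :+ x :+ y := A :+ y :+ x) refl A 1 (r * d) ⟩
    A + r * d + 1         ∎)
    where
    open ≡-Reasoning
    A = a rr
    d = j l ∸ j rr

  private
    cross-bound : ∀ {y d A H w w′} → r * y ≡ A + 1 → H + w ≤ w′ + r * w → w′ ≤ w →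
      y * H * (A + r * d) + w′ * A ≤ (y + d) * H * A + w * (A + r * d)
    cross-bound {y} {d} {A} {H} {w} {w′} ry≡A+1 H+w≤ w′≤w = begin
      y * H * (A + r * d) + w′ * A
        ≡⟨ solve 6 (λ y H A r d w → y :* H :* (A :+ r :* d) :+ w :* A := y :* H :* A :+ d :* H :* (r :* y) :+ w :* A) refl y H A r d w′ ⟩
      y * H * A + d * H * (r * y) + w′ * A
        ≡⟨ cong (λ x → y * H * A + d * H * x + w′ * A) ry≡A+1 ⟩
      y * H * A + d * H * (A + 1) + w′ * A
        ≡⟨ solve 5 (λ y H A d w → y :* H :* A :+ d :* H :* (A :+ con 1) :+ w :* A := y :* H :* A :+ d :* H :* A :+ (d :* H :+ w :* A))
             refl y H A d w′ ⟩
      y * H * A + d * H * A + (d * H + w′ * A)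
        ≤⟨ +-monoʳ-≤ (y * H * A + d * H * A) key ⟩
      y * H * A + d * H * A + (w * A + r * d * w)
        ≡⟨ solve 6 (λ y H A d h r → y :* H :* A :+ d :* H :* A :+ (h :* A :+ r :* d :* h) := (y :+ d) :* H :* A :+ h :* (A :+ r :* d))
             refl y H A d w r ⟩
      (y + d) * H * A + w * (A + r * d)             ∎
      where
      open ≤-Reasoning
      key : d * H + w′ * A ≤ w * A + r * d * w
      key = +-cancelʳ-≤ (d * w + d * w′) _ _ (begin
        d * H + w′ * A + (d * w + d * w′)
          ≡⟨ solve 5 (λ d H w′ A w → d :* H :+ w′ :* A :+ (d :* w :+ d :* w′) := d :* (H :+ w) :+ w′ :* (d :+ A)) refl d H w′ A w ⟩
        d * (H + w) + w′ * (d + A)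
          ≤⟨ +-mono-≤ (*-monoʳ-≤ d H+w≤) (*-monoˡ-≤ (d + A) w′≤w) ⟩
        d * (w′ + r * w) + w * (d + A)
          ≡⟨ solve 5 (λ d w′ r w A → d :* (w′ :+ r :* w) :+ w :* (d :+ A) := w :* A :+ r :* d :* w :+ (d :* w :+ d :* w′)) refl d w′ r w A ⟩
        w * A + r * d * w + (d * w + d * w′)        ∎)

  -- S l = j l · ∑ weight − weight l, so W is added to both sides to avoid truncated subtraction.
  minimal : ∀ l → S rr * a l ≤ S l * a rr
  minimal l = +-cancelʳ-≤ W (S rr * a l) (S l * A) (begin
    S rr * a l + W
      ≡⟨ solve 5 (λ s h a hl A → s :* a :+ (h :* a :+ hl :* A) := (s :+ h) :* a :+ hl :* A) refl (S rr) (weight rr) (a l) (weight l) A ⟩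
    (S rr + weight rr) * a l + weight l * A
      ≡⟨ cong₂ (λ x y → x * y + weight l * A) (S+weight≡ rr) (a≡a-rr+r*Δj l) ⟩
    j rr * H * (A + r * d) + weight l * A
      ≤⟨ cross-bound (sym (a+1≡rj rr)) (∑-≤-others weight weight-max l) (weight-max l) ⟩
    (j rr + d) * H * A + weight rr * (A + r * d)
      ≡⟨ cong₂ (λ x y → x * H * A + weight rr * y) (m+[n∸m]≡n (j-min l)) (sym (a≡a-rr+r*Δj l)) ⟩
    j l * H * A + weight rr * a l
      ≡⟨ cong (λ x → x * A + weight rr * a l) (S+weight≡ l) ⟨
    (S l + weight l) * A + weight rr * a l
      ≡⟨ solve 5 (λ s hl A h a → (s :+ hl) :* A :+ h :* a := s :* A :+ (h :* a :+ hl :* A)) refl (S l) (weight l) A (weight rr) (a l) ⟩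
    S l * A + W                                     ∎)
    where
    open ≤-Reasoning
    d = j l ∸ j rr
    A = a rr
    H = ∑ weight
    W = weight rr * a l + weight l * A

  term≡ : ∀ c → term k r (j c) Sign.- ℚ.* ℕ→ℚ (∏a^j * (∑ j) !) ≡ ℕ→ℚ (weight c * ∏j!)
  term≡ c = begin
    term k r (j c) Sign.- ℚ.* ℕ→ℚ (∏a^j * (∑ j) !)
      ≡⟨ cong (λ t → t ℚ.* ℕ→ℚ (∏a^j * (∑ j) !))
           (trans (cong₂ (λ x y → 1ℚ ÷ (ℤ→ℚ x ÷ ℤ→ℚ y)) numerator denominator) (1÷[u÷w] (ℕ→ℚ≢0 X>0) (ℕ→ℚ≢0 Y>0))) ⟩
    (2 * j c) /ℕ ((2 * k + 2) * a c) ℚ.* ℕ→ℚ (∏a^j * (∑ j) !)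
      ≡⟨ /ℕ-*-≡ {2 * j c} {(2 * k + 2) * a c} {∏a^j * (∑ j) !} {weight c * ∏j!} X>0 cross ⟩
    ℕ→ℚ (weight c * ∏j!) ∎
    where
    open ≡-Reasoning
    X>0 : 0 < (2 * k + 2) * a c
    X>0 = *-mono-< (≤-trans (s≤s z≤n) (m≤n+m 2 (2 * k))) (a>0 c)
    Y>0 : 0 < 2 * j c
    Y>0 = *-mono-< (s≤s (z≤n {1})) (j>0 c)
    numerator : (ℤ.+ (2 * k + 1) ℤ.- ℤ.-1ℤ) ℤ.* (ℤ.+ (r * j c) ℤ.+ ℤ.-1ℤ) ≡ ℤ.+ ((2 * k + 2) * a c)
    numerator = trans (cong₂ ℤ._*_ (trans (sym (ℤP.pos-+ (2 * k + 1) 1)) (cong ℤ.+_ (+-assoc (2 * k) 1 1)))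
                                   (trans (cong (λ x → ℤ.+ x ℤ.+ ℤ.-1ℤ) (sym (a+1≡rj c))) (+[m+1]-1 (a c))))
                      (sym (ℤP.pos-* (2 * k + 2) (a c)))
    denominator : ℤ.+ (2 * j c + 1) ℤ.+ ℤ.-1ℤ ≡ ℤ.+ (2 * j c)
    denominator = +[m+1]-1 (2 * j c)
    cross : 2 * j c * (∏a^j * (∑ j) !) ≡ weight c * ∏j! * ((2 * k + 2) * a c)
    cross = begin
      2 * j c * (∏a^j * (∑ j) !)
        ≡⟨ cong (λ m → 2 * j c * (∏a^j * m !)) ∑j≡k+1 ⟩
      2 * j c * (∏a^j * (suc k * k !))
        ≡⟨ solve 4 (λ x Q k f → con 2 :* x :* (Q :* ((con 1 :+ k) :* f)) := con 2 :* (con 1 :+ k) :* (x :* Q :* f))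
             refl (j c) ∏a^j k (k !) ⟩
      2 * suc k * (j c * ∏a^j * k !)
        ≡⟨ cong (2 * suc k *_) (weight-spec c) ⟨
      2 * suc k * (weight c * a c * ∏j!)
        ≡⟨ solve 4 (λ k w a W → con 2 :* (con 1 :+ k) :* (w :* a :* W) := w :* W :* ((con 2 :* k :+ con 2) :* a))
             refl k (weight c) (a c) ∏j! ⟩
      weight c * ∏j! * ((2 * k + 2) * a c)        ∎

  S≡ℚ : ℕ→ℚ (S rr) ≡ ℕ→ℚ (j rr) ℚ.* ℕ→ℚ (∑ weight) ℚ.+ ℤ→ℚ (σℤ Sign.-) ℚ.* ℕ→ℚ (weight rr)
  S≡ℚ = begin
    ℕ→ℚ (S rr)
      ≡⟨ solveℚ 2 (λ s w → s ⊜ (s ⊕ w) ⊕ (⊝ conℚ 1ℚ) ⊛ w) refl (ℕ→ℚ (S rr)) (ℕ→ℚ (weight rr)) ⟩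
    ℕ→ℚ (S rr) ℚ.+ ℕ→ℚ (weight rr) ℚ.+ (ℚ.- 1ℚ) ℚ.* ℕ→ℚ (weight rr)
      ≡⟨ cong (ℚ._+ (ℚ.- 1ℚ) ℚ.* ℕ→ℚ (weight rr))
           (trans (sym (ℕ→ℚ-homo-+ (S rr) (weight rr))) (trans (cong ℕ→ℚ (S+weight≡ rr)) (ℕ→ℚ-homo-* (j rr) (∑ weight)))) ⟩
    ℕ→ℚ (j rr) ℚ.* ℕ→ℚ (∑ weight) ℚ.+ (ℚ.- 1ℚ) ℚ.* ℕ→ℚ (weight rr)
      ≡⟨ cong (λ x → ℕ→ℚ (j rr) ℚ.* ℕ→ℚ (∑ weight) ℚ.+ x ℚ.* ℕ→ℚ (weight rr)) (ℤ→ℚ-homo-neg ℤ.1ℤ) ⟨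
    ℕ→ℚ (j rr) ℚ.* ℕ→ℚ (∑ weight) ℚ.+ ℤ→ℚ (σℤ Sign.-) ℚ.* ℕ→ℚ (weight rr) ∎
    where open ≡-Reasoning

  T≡j-e : ∀ c i → ℤ.+ T c i ≡ ℤ.+ j i ℤ.+ (if ⌊ i Fin.≟ c ⌋ then ℤ.-1ℤ else ℤ.0ℤ)
  T≡j-e c i = by (i Fin.≟ c)
    where
    by : (i≟c : Dec (i ≡ c)) → ℤ.+ T c i ≡ ℤ.+ j i ℤ.+ (if ⌊ i≟c ⌋ then ℤ.-1ℤ else ℤ.0ℤ)
    by (yes refl) = trans (sym (+[m+1]-1 (T i i))) (cong (λ x → ℤ.+ x ℤ.+ ℤ.-1ℤ) (T-here i))
    by (no i≢c)   = trans (cong ℤ.+_ (T-off (i≢c ∘ sym))) (sym (ℤP.+-identityʳ (ℤ.+ j i)))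

  realisation : Realisation k r hk hr j Sign.-
  realisation = record
    { a        = a
    ; T        = T
    ; a≡rj+σ   = a≡rj-1
    ; T≡j+σe   = T≡j-e
    ; ∑T≡k     = ∑T≡k
    ; a>0      = a>0
    ; ∑a≡kr    = ∑a≡kr
    ; distinct = distinct
    ; minimal  = minimal
    ; formula≡ = FormulaValue.formula≡ k r hr j Sign.- a weight (S rr) (≤-trans (s≤s z≤n) hk) a>0 a≡rj-1 term≡ S≡ℚ
    }
    where
    a≡rj-1 : ∀ i → ℤ.+ a i ≡ rjσ r (j i) Sign.-
    a≡rj-1 i = trans (sym (+[m+1]-1 (a i))) (cong (λ x → ℤ.+ x ℤ.+ ℤ.-1ℤ) (a+1≡rj i))

module _ (k r : ℕ) (j : Fin r → ℕ) where

  valid⁺-sum : Valid k r j Sign.+ → suc (∑ j) ≡ k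
  valid⁺-sum (1+∑j≡k , _) = trans (cong suc (sym (sumℕ≡∑ j))) (ℤP.+-injective 1+∑j≡k)

  valid⁻-sum : Valid k r j Sign.- → ∑ j ≡ suc k
  valid⁻-sum (-1+∑j≡k , _) = trans (sym (sumℕ≡∑ j)) (by (sumℕ j) -1+∑j≡k)
    where
    by : ∀ s → ℤ.-1ℤ ℤ.+ ℤ.+ s ≡ ℤ.+ k → s ≡ suc k
    by (suc s) eq = cong suc (ℤP.+-injective eq)

  valid⁻-pos : Valid k r j Sign.- → ∀ i → 0 < j i
  valid⁻-pos (_ , j-1≥0) i = by (j i) (j-1≥0 i)
    where
    by : ∀ x → ℤ.0ℤ ℤ.≤ ℤ.+ x ℤ.+ ℤ.-1ℤ → 0 < x
    by (suc x) _ = s≤s z≤n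

last-minimal : ∀ {r} (j : Fin r → ℕ) (hr : 2 ≤ r) → NonIncreasing j → ∀ l → j (lastIx r hr) ≤ j l
last-minimal {suc m} j hr non-increasing l = non-increasing l (fromℕ m) (≤fromℕ l)

lemma4p2 : (k r : ℕ) → (hk : 2 ≤ k) → (hr : 2 ≤ r) →
  (j : Fin r → ℕ) → (σ : Sign) → Valid k r j σ → NonIncreasing j →
  LimitOfMaxIs k r j σ (formula k r hr j σ)
lemma4p2 k r hk hr j Sign.+ valid non-increasing =
  Realisation.limit (Positive.realisation k r hk hr j (valid⁺-sum k r j valid) (last-minimal j hr non-increasing))
lemma4p2 k r hk hr j Sign.- valid non-increasing =
  Realisation.limit (Negative.realisation k r hk hr j (valid⁻-sum k r j valid) (valid⁻-pos k r j valid) (last-minimal j hr non-increasing))
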